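{- Let $a,b$ be integers, and set $f_7(a,b)=a^3+5a^2b-8ab^2+b^3$ and $g_7(a,b)=a^2-ab+b^2$. Suppose $f_7(a,b)=q$ is a prime. Then $q\equiv\pm1\pmod 7$; moreover $q\equiv 1\pmod 7$ if and only if $\left(\frac{ -7g_7(a,b)}{q}\right)=1$, and $q\equiv -1\pmod 7$ if and only if $\left(\frac{ -7g_7(a,b)}{q}\right)=-1$.
   Context: $\left(\frac{\cdot}{q}\right)$ denotes the Legendre symbol modulo $q$. -}

module Defs where

open import Data.Nat as ℕ using (ℕ)
open import Data.Integer using (ℤ; +_; -[1+_]; _+_; _-_; _*_; -_; _^_; _%_)
open import Data.Integer.Divisibility.Signed using (_∣_; _∣?_)
import Data.Integer.Properties as ℤP
open import Data.List using (upTo)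
open import Data.List.Relation.Unary.Any using (any?)
open import Relation.Nullary using (yes; no)

f7 : ℤ → ℤ → ℤ
f7 a b = a ^ 3 + + 5 * (a ^ 2) * b - + 8 * a * (b ^ 2) + b ^ 3

g7 : ℤ → ℤ → ℤ
g7 a b = a ^ 2 - a * b + b ^ 2

-- Squares mod q are searched among residues y ∈ {0,…,q−1}, which is
-- exhaustive.  Intended for q an odd prime.
legendre : ℤ → ℕ → ℤ
legendre x q with (+ q) ∣? x
... | yes _ = + 0
... | no _ with any? (λ y → (+ q) ∣? (+ y * + y - x)) (upTo q)
...   | yes _ = + 1
...   | no _ = -[1+ 0 ]

module Submission where

-- Put c = a + 4b.  Since f₇(a,b) = c³ − 7c²b + 49b³, q ≡ c³ (mod 7), and c⁶ ≡ 1 forces c³ ≡ ±1.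
-- For the Legendre symbol put u = 2b − 3a, v = 2a + b and work in 𝔽_q[Y]/(Y² − uY + v²), whose
-- conjugation is Y ↦ Ȳ = u − Y.  Modulo f₇(a,b) one has Y⁶ = v⁵Ȳ, hence Y⁷ = v⁷, so the Frobenius
-- fixes Y when q ≡ 1 and exchanges Y and Ȳ when q ≡ −1 (mod 7).  Raising δ = 2Y − u to the q-th
-- power, once through the Frobenius and once as δ·(δ²)^((q−1)/2) with δ² = d = u² − 4v², shows
-- d^((q−1)/2) = ±1 accordingly.  Finally −7g₇(a,b)·d ≡ (7(a² + 2ab − b²))² is a nonzero square
-- modulo q, and Euler's criterion, proved by pairing residues with their partners as in Wilson's
-- theorem, turns d^((q−1)/2) into the Legendre symbol of −7g₇(a,b).

open import Algebra.Bundles using (CommutativeSemiring)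
open import Algebra.Core using (Op₂)
import Algebra.Definitions as Definitions
open import Algebra.Structures using (IsCommutativeSemiring; IsCommutativeMonoid)
open import Algebra.Structures.Biased using (IsCommutativeSemiringˡ)
open import Data.Empty using (⊥; ⊥-elim)
open import Data.Fin.Base using (Fin; toℕ; inject₁; fromℕ)
import Data.Fin.Properties as Finₚ
import Data.Integer.Base as ℤ
open import Data.Integer.DivMod using (a≡a%ℕn+[a/ℕn]*n; n%ℕd<d)
open import Data.Integer.Divisibility.Signed
  using (_∣_; _∣?_; divides; ∣⇒∣ᵤ; ∣ᵤ⇒∣; ∣-refl; ∣m⇒∣m*n; ∣n⇒∣m*n; ∣m∣n⇒∣m+n; ∣m∣n⇒∣m-n; ∣m⇒∣-m)
import Data.Integer.Properties as ℤₚ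
open import Data.Integer.Tactic.RingSolver using (solve-∀)
open import Data.List.Base using (List; []; _∷_; _∷ʳ_; length; foldr; applyUpTo; upTo)
import Data.List.Properties as Listₚ
open import Data.List.Membership.Propositional using (_∈_)
open import Data.List.Membership.Propositional.Properties using (∈-applyUpTo⁺; ∈-applyUpTo⁻; ∈-upTo⁺)
open import Data.List.Relation.Unary.All as All using ([]; _∷_)
import Data.List.Relation.Unary.All.Properties as Allₚ
open import Data.List.Relation.Unary.AllPairs using (AllPairs; []; _∷_)
import Data.List.Relation.Unary.AllPairs.Properties as AllPairsₚ
open import Data.List.Relation.Unary.Any as Any using (here; there; _─_; index; any?)
open import Data.Nat.Base as ℕ using (ℕ; zero; suc; _∸_; _<_; _≤_; s≤s; z≤n; _%_; _/_; NonZero)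
open import Data.Nat.Combinatorics using (_C_; nCn≡1; nC1≡n; nCk+nC[k+1]≡[n+1]C[k+1]; k>n⇒nCk≡0)
import Data.Nat.Divisibility as ℕᵈ
open import Data.Nat.DivMod using (m<n⇒m%n≡m; m≡m%n+[m/n]*n; m%n<n)
open import Data.Nat.Induction using (<-wellFounded)
open import Data.Nat.Primality using (Prime; prime?; euclidsLemma; prime⇒irreducible; prime⇒nonZero; ¬prime[1])
import Data.Nat.Properties as ℕₚ
open import Data.Nat.Solver using (module +-*-Solver)
open import Data.Product.Base using (∃-syntax; _×_; _,_; proj₁; proj₂)
open import Data.Sum.Base as Sum using (_⊎_; inj₁; inj₂)
open import Data.Vec.Functional using (Vector; replicate; init; tail)
open import Function.Base using (_∘_; id; case_of_)
open import Function.Bundles using (_⇔_; mk⇔)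
open import Induction.WellFounded using (Acc; acc)
open import Level using (0ℓ)
open import Relation.Binary.Bundles using (Setoid)
open import Relation.Binary.Core using (Rel)
open import Relation.Binary.PropositionalEquality as ≡ using (_≡_; _≢_; refl; cong; cong₂; module ≡-Reasoning)
open import Relation.Binary.Structures using (IsEquivalence)
open import Relation.Nullary.Decidable using (yes; no; toWitness)
open import Relation.Nullary.Negation using (¬_; contradiction)

open import Defs

private
  variable
    n p : ℕ

[1+k]*[1+n]C[1+k]≡[1+n]*nCk : ∀ n k → suc k ℕ.* (suc n C suc k) ≡ suc n ℕ.* (n C k)
[1+k]*[1+n]C[1+k]≡[1+n]*nCk zero zero = refl
[1+k]*[1+n]C[1+k]≡[1+n]*nCk zero (suc k)
  rewrite k>n⇒nCk≡0 {1} {suc (suc k)} (s≤s (s≤s z≤n)) | k>n⇒nCk≡0 {0} {suc k} (s≤s z≤n)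
  = ℕₚ.*-zeroʳ (suc (suc k))
[1+k]*[1+n]C[1+k]≡[1+n]*nCk (suc n) zero = begin
  1 ℕ.* (suc (suc n) C 1) ≡⟨ ℕₚ.*-identityˡ _ ⟩
  suc (suc n) C 1         ≡⟨ nC1≡n (suc (suc n)) ⟩
  suc (suc n)             ≡⟨ ℕₚ.*-identityʳ (suc (suc n)) ⟨
  suc (suc n) ℕ.* 1       ∎
  where open ≡-Reasoning
[1+k]*[1+n]C[1+k]≡[1+n]*nCk (suc n) (suc k) = begin
  suc (suc k) ℕ.* (suc (suc n) C suc (suc k))
    ≡⟨ cong (suc (suc k) ℕ.*_) (nCk+nC[k+1]≡[n+1]C[k+1] (suc n) (suc k)) ⟨
  suc (suc k) ℕ.* (A ℕ.+ B)
    ≡⟨ regroup (suc k) A B ⟩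
  A ℕ.+ (suc k ℕ.* A ℕ.+ suc (suc k) ℕ.* B)
    ≡⟨ cong (A ℕ.+_) (cong₂ ℕ._+_ ([1+k]*[1+n]C[1+k]≡[1+n]*nCk n k) ([1+k]*[1+n]C[1+k]≡[1+n]*nCk n (suc k))) ⟩
  A ℕ.+ (suc n ℕ.* (n C k) ℕ.+ suc n ℕ.* (n C suc k))
    ≡⟨ cong (A ℕ.+_) (ℕₚ.*-distribˡ-+ (suc n) (n C k) (n C suc k)) ⟨
  A ℕ.+ suc n ℕ.* (n C k ℕ.+ n C suc k)
    ≡⟨ cong (λ m → A ℕ.+ suc n ℕ.* m) (nCk+nC[k+1]≡[n+1]C[k+1] n k) ⟩
  A ℕ.+ suc n ℕ.* A
    ∎
  where
  open ≡-Reasoning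
  open +-*-Solver
  A = suc n C suc k
  B = suc n C suc (suc k)
  regroup : ∀ k A B → (1 ℕ.+ k) ℕ.* (A ℕ.+ B) ≡ A ℕ.+ (k ℕ.* A ℕ.+ (1 ℕ.+ k) ℕ.* B)
  regroup = solve 3 (λ k A B → (con 1 :+ k) :* (A :+ B) := A :+ (k :* A :+ (con 1 :+ k) :* B)) refl

prime∣pCk : ∀ {p k} → Prime p → 0 < k → k < p → p ℕᵈ.∣ p C k
prime∣pCk {suc n} {suc k} p-prime _ k<p
  with euclidsLemma (suc k) (suc n C suc k) p-prime
         (ℕᵈ.divides (n C k) (≡.trans ([1+k]*[1+n]C[1+k]≡[1+n]*nCk n k) (ℕₚ.*-comm (suc n) (n C k))))
... | inj₂ p∣C  = p∣C
... | inj₁ p∣1+k = contradiction (ℕᵈ.∣⇒≤ p∣1+k) (ℕₚ.<⇒≱ k<p)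

module Frobenius {c ℓ} (S : CommutativeSemiring c ℓ) where
  open CommutativeSemiring S renaming (refl to ≈-refl; sym to ≈-sym; trans to ≈-trans; zero to *-zero)
  open import Algebra.Properties.Semiring.Exp semiring using (_^_; ^-congʳ)
  open import Algebra.Properties.Monoid.Mult +-monoid using (×-assocˡ; ×-congʳ; ×-congˡ; ×-homo-1) renaming (_×_ to _·_)
  open import Algebra.Properties.Monoid.Sum +-monoid using (sum; sum-cong-≋; sum-replicate-zero; sum-init-last)
  open import Algebra.Properties.CommutativeSemiring.Binomial S using (binomialTerm) renaming (theorem to binomial-theorem)
  open import Relation.Binary.Reasoning.Setoid setoid

  private
    ×-zeroʳ : ∀ n → n · 0# ≈ 0#
    ×-zeroʳ zero    = ≈-refl
    ×-zeroʳ (suc n) = ≈-trans (+-identityˡ _) (×-zeroʳ n)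

    sum≈first+last : ∀ {m} (t : Vector Carrier (suc (suc m))) → (∀ i → t (Fin.suc (inject₁ i)) ≈ 0#) →
                     sum t ≈ t Fin.zero + t (fromℕ (suc m))
    sum≈first+last {m} t inner≈0 = +-cong ≈-refl (begin
      sum (tail t)                                ≈⟨ sum-init-last (tail t) ⟩
      sum (init (tail t)) + t (fromℕ (suc m))     ≈⟨ +-congʳ (sum-cong-≋ {m} {init (tail t)} {replicate m 0#} inner≈0) ⟩
      sum (replicate m 0#) + t (fromℕ (suc m))    ≈⟨ +-congʳ (sum-replicate-zero m) ⟩
      0# + t (fromℕ (suc m))                      ≈⟨ +-identityˡ _ ⟩
      t (fromℕ (suc m))                           ∎)

  frobenius : Prime p → (∀ x → p · x ≈ 0#) → ∀ x y → (x + y) ^ p ≈ x ^ p + y ^ p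
  frobenius {p@(suc (suc m))} p-prime char x y = begin
    (x + y) ^ p                                                ≈⟨ binomial-theorem p x y ⟩
    sum (binomialTerm x y p)                                   ≈⟨ sum≈first+last (binomialTerm x y p) inner≈0 ⟩
    binomialTerm x y p Fin.zero + binomialTerm x y p (fromℕ p) ≈⟨ +-cong first≈ last≈ ⟩
    y ^ p + x ^ p                                              ≈⟨ +-comm _ _ ⟩
    x ^ p + y ^ p                                              ∎
    where
    inner≈0 : ∀ (i : Fin (suc m)) → binomialTerm x y p (Fin.suc (inject₁ i)) ≈ 0#
    inner≈0 i with prime∣pCk p-prime (s≤s z≤n) (s≤s (≡.subst (_< suc m) (≡.sym (Finₚ.toℕ-inject₁ i)) (Finₚ.toℕ<n i)))
    ... | ℕᵈ.divides d C≡d*p =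
      ≈-trans (×-congˡ C≡d*p) (≈-trans (≈-sym (×-assocˡ _ d p)) (≈-trans (×-congʳ d (char _)) (×-zeroʳ d)))

    first≈ : binomialTerm x y p Fin.zero ≈ y ^ p
    first≈ = ≈-trans (×-homo-1 _) (*-identityˡ _)

    last≈ : binomialTerm x y p (fromℕ p) ≈ x ^ p
    last≈ = top (toℕ (fromℕ p)) (Finₚ.toℕ-fromℕ p)
      where
      top : ∀ k → k ≡ p → (p C k) · (x ^ k * y ^ (p ∸ k)) ≈ x ^ p
      top .p refl = ≈-trans (×-congˡ (nCn≡1 p))
        (≈-trans (×-homo-1 _) (≈-trans (*-congˡ (^-congʳ y (ℕₚ.n∸n≡0 p))) (*-identityʳ _)))

open ℤ using (ℤ; +_; -[1+_]; _+_; _-_; _*_; -_; _^_)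

private
  variable
    x y z x′ y′ : ℤ

module _ {A : Set} {_≈_ : Rel A 0ℓ} (≈-isEquivalence : IsEquivalence _≈_)
         {_+_ _*_ : Op₂ A} {0# 1# : A}
         (+-cong : Definitions.Congruent₂ _≈_ _+_) (*-cong : Definitions.Congruent₂ _≈_ _*_)
         (+-assoc : Definitions.Associative _≡_ _+_) (+-comm : Definitions.Commutative _≡_ _+_)
         (+-identityˡ : Definitions.LeftIdentity _≡_ 0# _+_)
         (*-assoc : Definitions.Associative _≡_ _*_) (*-comm : Definitions.Commutative _≡_ _*_)
         (*-identityˡ : Definitions.LeftIdentity _≡_ 1# _*_)
         (*-distribʳ-+ : Definitions._DistributesOverʳ_ _≡_ _*_ _+_) (*-zeroˡ : Definitions.LeftZero _≡_ 0# _*_)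
  where
  open IsEquivalence ≈-isEquivalence using (reflexive)

  private
    isCommutativeMonoid : ∀ {_∙_ ε} → Definitions.Congruent₂ _≈_ _∙_ → Definitions.Associative _≡_ _∙_ →
                          Definitions.Commutative _≡_ _∙_ → Definitions.LeftIdentity _≡_ ε _∙_ →
                          IsCommutativeMonoid _≈_ _∙_ ε
    isCommutativeMonoid {_∙_} {ε} ∙-cong assoc comm identityˡ = record
      { isMonoid = record
        { isSemigroup = record
          { isMagma = record { isEquivalence = ≈-isEquivalence ; ∙-cong = ∙-cong }
          ; assoc   = λ x y z → reflexive (assoc x y z) }
        ; identity = (λ x → reflexive (identityˡ x)) , (λ x → reflexive (≡.trans (comm x ε) (identityˡ x))) }
      ; comm = λ x y → reflexive (comm x y) }

  isCommutativeSemiring-from-≡-laws : IsCommutativeSemiring _≈_ _+_ _*_ 0# 1#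
  isCommutativeSemiring-from-≡-laws = IsCommutativeSemiringˡ.isCommutativeSemiring record
    { +-isCommutativeMonoid = isCommutativeMonoid +-cong +-assoc +-comm +-identityˡ
    ; *-isCommutativeMonoid = isCommutativeMonoid *-cong *-assoc *-comm *-identityˡ
    ; distribʳ              = λ x y z → reflexive (*-distribʳ-+ x y z)
    ; zeroˡ                 = λ x → reflexive (*-zeroˡ x) }

-- A record rather than a synonym for divisibility, so that x, y and n can be inferred from a proof.
infix 4 _≡_mod_
record _≡_mod_ (x y : ℤ) (n : ℕ) : Set where
  constructor congruent
  field modulus∣difference : + n ∣ x - y
open _≡_mod_

≡-mod-reflexive : x ≡ y → x ≡ y mod n
≡-mod-reflexive {x = x} {n = n} refl = congruent (divides (+ 0) (≡.trans (ℤₚ.+-inverseʳ x) (≡.sym (ℤₚ.*-zeroˡ (+ n)))))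

≡-mod-refl : x ≡ x mod n
≡-mod-refl = ≡-mod-reflexive refl

≡-mod-sym : x ≡ y mod n → y ≡ x mod n
≡-mod-sym {x = x} {y = y} (congruent n∣x-y) = congruent (≡.subst (_ ∣_) (negate x y) (∣m⇒∣-m n∣x-y))
  where negate : ∀ x y → - (x - y) ≡ y - x
        negate = solve-∀

≡-mod-trans : x ≡ y mod n → y ≡ z mod n → x ≡ z mod n
≡-mod-trans {x = x} {y = y} {z = z} (congruent n∣x-y) (congruent n∣y-z) =
  congruent (≡.subst (_ ∣_) (telescope x y z) (∣m∣n⇒∣m+n n∣x-y n∣y-z))
  where telescope : ∀ x y z → (x - y) + (y - z) ≡ x - z
        telescope = solve-∀

≡-mod-isEquivalence : IsEquivalence (λ x y → x ≡ y mod n)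
≡-mod-isEquivalence = record { refl = ≡-mod-refl ; sym = ≡-mod-sym ; trans = ≡-mod-trans }

≡-mod-setoid : ℕ → Setoid 0ℓ 0ℓ
≡-mod-setoid n = record { isEquivalence = ≡-mod-isEquivalence {n} }

+-cong-mod : x ≡ y mod n → x′ ≡ y′ mod n → x + x′ ≡ y + y′ mod n
+-cong-mod {x = x} {y = y} {x′ = x′} {y′ = y′} (congruent n∣x-y) (congruent n∣x′-y′) =
  congruent (≡.subst (_ ∣_) (regroup x y x′ y′) (∣m∣n⇒∣m+n n∣x-y n∣x′-y′))
  where regroup : ∀ x y x′ y′ → (x - y) + (x′ - y′) ≡ (x + x′) - (y + y′)
        regroup = solve-∀

*-cong-mod : x ≡ y mod n → x′ ≡ y′ mod n → x * x′ ≡ y * y′ mod n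
*-cong-mod {x = x} {y = y} {x′ = x′} {y′ = y′} (congruent n∣x-y) (congruent n∣x′-y′) =
  congruent (≡.subst (_ ∣_) (regroup x y x′ y′) (∣m∣n⇒∣m+n (∣m⇒∣m*n x′ n∣x-y) (∣n⇒∣m*n y n∣x′-y′)))
  where regroup : ∀ x y x′ y′ → (x - y) * x′ + y * (x′ - y′) ≡ x * x′ - y * y′
        regroup = solve-∀

*-congˡ-mod : ∀ x → y ≡ z mod n → x * y ≡ x * z mod n
*-congˡ-mod x y≡z = *-cong-mod (≡-mod-refl {x = x}) y≡z

*-congʳ-mod : ∀ z → x ≡ y mod n → x * z ≡ y * z mod n
*-congʳ-mod z x≡y = *-cong-mod x≡y (≡-mod-refl {x = z})

-‿cong-mod : x ≡ y mod n → - x ≡ - y mod n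
-‿cong-mod {x = x} {y = y} (congruent n∣x-y) = congruent (≡.subst (_ ∣_) (negate x y) (∣m⇒∣-m n∣x-y))
  where negate : ∀ x y → - (x - y) ≡ - x - - y
        negate = solve-∀

^-cong-mod : ∀ k → x ≡ y mod n → x ^ k ≡ y ^ k mod n
^-cong-mod zero    _   = ≡-mod-refl
^-cong-mod (suc k) x≡y = *-cong-mod x≡y (^-cong-mod k x≡y)

∣⇒≡-mod-0 : + n ∣ x → x ≡ + 0 mod n
∣⇒≡-mod-0 {n = n} {x = x} n∣x = congruent (≡.subst (+ n ∣_) (≡.sym (ℤₚ.+-identityʳ x)) n∣x)

≡-mod-0⇒∣ : x ≡ + 0 mod n → + n ∣ x
≡-mod-0⇒∣ {x = x} {n = n} (congruent n∣x-0) = ≡.subst (+ n ∣_) (ℤₚ.+-identityʳ x) n∣x-0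

%ℕ-≡-mod : ∀ x n .{{_ : NonZero n}} → + (x ℤ.%ℕ n) ≡ x mod n
%ℕ-≡-mod x n = congruent (divides (- (x ℤ./ℕ n)) (begin
  + (x ℤ.%ℕ n) - x                                   ≡⟨ cong (λ w → + (x ℤ.%ℕ n) - w) (a≡a%ℕn+[a/ℕn]*n x n) ⟩
  + (x ℤ.%ℕ n) - (+ (x ℤ.%ℕ n) + (x ℤ./ℕ n) * + n)   ≡⟨ cancel (+ (x ℤ.%ℕ n)) (x ℤ./ℕ n) (+ n) ⟩
  - (x ℤ./ℕ n) * + n                                 ∎))
  where
  open ≡-Reasoning
  cancel : ∀ r k n → r - (r + k * n) ≡ - k * n
  cancel = solve-∀

-1≡n-mod-1+n : ∀ n → - + 1 ≡ + n mod suc n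
-1≡n-mod-1+n n = ≡-mod-sym (congruent (divides (+ 1) (≡.trans (cong +_ (ℕₚ.+-comm n 1)) (≡.sym (ℤₚ.*-identityˡ (+ suc n))))))

private
  +-injective-mod-≤ : ∀ {i j} → i ≤ j → j < n → + i ≡ + j mod n → i ≡ j
  +-injective-mod-≤ {n} {i} i≤j j<n (congruent n∣i-j) with ℕₚ.m≤n⇒∃[o]m+o≡n i≤j
  ... | d , refl = ≡.sym (≡.trans (cong (i ℕ.+_) d≡0) (ℕₚ.+-identityʳ i))
    where
    d<n = ℕₚ.≤-<-trans (ℕₚ.m≤n+m d i) j<n
    instance _ = ℕ.>-nonZero (ℕₚ.≤-<-trans z≤n d<n)
    n∣d : + n ∣ + d
    n∣d = ≡.subst (_ ∣_) (≡.trans (cong (λ w → - (+ i - w)) (ℤₚ.pos-+ i d)) (cancel (+ i) (+ d))) (∣m⇒∣-m n∣i-j)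
      where cancel : ∀ x y → - (x - (x + y)) ≡ y
            cancel = solve-∀
    d≡0 : d ≡ 0
    d≡0 = ≡.trans (≡.sym (m<n⇒m%n≡m d<n)) (ℕᵈ.n∣m⇒m%n≡0 d n (∣⇒∣ᵤ n∣d))

+-injective-mod : ∀ {i j} → i < n → j < n → + i ≡ + j mod n → i ≡ j
+-injective-mod {i = i} {j} i<n j<n i≡j with ℕₚ.≤-total i j
... | inj₁ i≤j = +-injective-mod-≤ i≤j j<n i≡j
... | inj₂ j≤i = ≡.sym (+-injective-mod-≤ j≤i i<n (≡-mod-sym i≡j))

≡-mod⇒% : ∀ {m r} .{{_ : NonZero n}} → r < n → + m ≡ + r mod n → m % n ≡ r
≡-mod⇒% {n} {m} r<n m≡r = +-injective-mod (m%n<n m n) r<n (≡-mod-trans (%ℕ-≡-mod (+ m) n) m≡r)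

ℤ-mod-commutativeSemiring : ℕ → CommutativeSemiring 0ℓ 0ℓ
ℤ-mod-commutativeSemiring n = record
  { _≈_ = λ x y → x ≡ y mod n ; _+_ = _+_ ; _*_ = _*_ ; 0# = + 0 ; 1# = + 1
  ; isCommutativeSemiring = isCommutativeSemiring-from-≡-laws ≡-mod-isEquivalence +-cong-mod *-cong-mod
      ℤₚ.+-assoc ℤₚ.+-comm ℤₚ.+-identityˡ ℤₚ.*-assoc ℤₚ.*-comm ℤₚ.*-identityˡ ℤₚ.*-distribʳ-+ ℤₚ.*-zeroˡ }

prime∣prime⇒≡ : ∀ {r} → Prime p → Prime r → p ℕᵈ.∣ r → p ≡ r
prime∣prime⇒≡ p-prime r-prime p∣r with prime⇒irreducible r-prime p∣r
... | inj₁ p≡1 = contradiction (≡.subst Prime p≡1 p-prime) ¬prime[1]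
... | inj₂ p≡r = p≡r

module _ {p : ℕ} (p-prime : Prime p) where

  private instance _ = prime⇒nonZero p-prime

  ∣*⇒∣⊎∣ : + p ∣ x * y → + p ∣ x ⊎ + p ∣ y
  ∣*⇒∣⊎∣ {x = x} {y = y} p∣xy with euclidsLemma ℤ.∣ x ∣ ℤ.∣ y ∣ p-prime (≡.subst (p ℕᵈ.∣_) (ℤₚ.abs-* x y) (∣⇒∣ᵤ p∣xy))
  ... | inj₁ p∣x = inj₁ (∣ᵤ⇒∣ p∣x)
  ... | inj₂ p∣y = inj₂ (∣ᵤ⇒∣ p∣y)

  ∤*∤ : ¬ + p ∣ x → ¬ + p ∣ y → ¬ + p ∣ x * y
  ∤*∤ p∤x p∤y p∣xy = Sum.[ p∤x , p∤y ] (∣*⇒∣⊎∣ p∣xy)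

  ∣^⇒∣ : ∀ k → + p ∣ x ^ k → + p ∣ x
  ∣^⇒∣ zero    p∣1 = contradiction (≡.subst Prime (ℕᵈ.∣1⇒≡1 (∣⇒∣ᵤ p∣1)) p-prime) ¬prime[1]
  ∣^⇒∣ {x = x} (suc k) p∣x*xᵏ = Sum.[ id , ∣^⇒∣ k ] (∣*⇒∣⊎∣ {x = x} p∣x*xᵏ)

  *-cancelˡ-mod : ¬ + p ∣ x → x * y ≡ x * z mod p → y ≡ z mod p
  *-cancelˡ-mod {x = x} {y = y} {z = z} p∤x (congruent p∣xy-xz) =
    Sum.[ (λ p∣x → contradiction p∣x p∤x) , congruent ] (∣*⇒∣⊎∣ (≡.subst (_ ∣_) (factor x y z) p∣xy-xz))
    where factor : ∀ x y z → x * y - x * z ≡ x * (y - z)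
          factor = solve-∀

  x²≡1⇒x≡±1 : x * x ≡ + 1 mod p → x ≡ + 1 mod p ⊎ x ≡ - + 1 mod p
  x²≡1⇒x≡±1 {x = x} (congruent p∣x²-1) = Sum.map congruent congruent (∣*⇒∣⊎∣ (≡.subst (+ p ∣_) (factor x) p∣x²-1))
    where factor : ∀ x → x * x - + 1 ≡ (x - + 1) * (x - - + 1)
          factor = solve-∀

  private
    open CommutativeSemiring (ℤ-mod-commutativeSemiring p) using (semiring; +-monoid)
    open import Algebra.Properties.Semiring.Exp semiring using () renaming (_^_ to _^ₛ_)
    open import Algebra.Properties.Monoid.Mult +-monoid using () renaming (_×_ to _·_)
    open Frobenius (ℤ-mod-commutativeSemiring p) using (frobenius)

    ·≡* : ∀ k x → k · x ≡ + k * x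
    ·≡* zero    x = ≡.sym (ℤₚ.*-zeroˡ x)
    ·≡* (suc k) x = ≡.trans (cong (λ w → x + w) (·≡* k x)) (≡.sym (ℤₚ.suc-* (+ k) x))

    ^ₛ≡^ : ∀ x k → x ^ₛ k ≡ x ^ k
    ^ₛ≡^ x zero    = refl
    ^ₛ≡^ x (suc k) = cong (x *_) (^ₛ≡^ x k)

    frobenius-ℤ : ∀ x y → (x + y) ^ p ≡ x ^ p + y ^ p mod p
    frobenius-ℤ x y rewrite ≡.sym (^ₛ≡^ (x + y) p) | ≡.sym (^ₛ≡^ x p) | ≡.sym (^ₛ≡^ y p) =
      frobenius p-prime (λ x → ∣⇒≡-mod-0 (≡.subst (+ p ∣_) (≡.sym (·≡* p x)) (∣m⇒∣m*n x ∣-refl))) x y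

    fermat-ℕ : ∀ k → (+ k) ^ p ≡ + k mod p
    fermat-ℕ zero    = ≡-mod-reflexive (≡.subst (λ m → (+ 0) ^ m ≡ + 0) (ℕₚ.suc-pred p) (ℤₚ.*-zeroˡ ((+ 0) ^ ℕ.pred p)))
    fermat-ℕ (suc k) = begin
      (+ 1 + + k) ^ p        ≈⟨ frobenius-ℤ (+ 1) (+ k) ⟩
      (+ 1) ^ p + (+ k) ^ p  ≈⟨ +-cong-mod (≡-mod-reflexive (ℤₚ.^-zeroˡ p)) (fermat-ℕ k) ⟩
      + 1 + + k              ∎
      where open import Relation.Binary.Reasoning.Setoid (≡-mod-setoid p)

  fermat : ∀ x → x ^ p ≡ x mod p
  fermat x = begin
    x ^ p        ≈⟨ ^-cong-mod p (≡-mod-sym (%ℕ-≡-mod x p)) ⟩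
    (+ r) ^ p    ≈⟨ fermat-ℕ r ⟩
    + r          ≈⟨ %ℕ-≡-mod x p ⟩
    x            ∎
    where
    open import Relation.Binary.Reasoning.Setoid (≡-mod-setoid p)
    r = x ℤ.%ℕ p

  fermat-little : ¬ + p ∣ x → x ^ ℕ.pred p ≡ + 1 mod p
  fermat-little {x = x} p∤x = *-cancelˡ-mod p∤x (begin
    x * x ^ ℕ.pred p    ≡⟨ cong (x ^_) (ℕₚ.suc-pred p) ⟩
    x ^ p               ≈⟨ fermat x ⟩
    x                   ≡⟨ ℤₚ.*-identityʳ x ⟨
    x * + 1             ∎)
    where open import Relation.Binary.Reasoning.Setoid (≡-mod-setoid p)

∃-solution : Prime p → ¬ + p ∣ x → ∀ a → ∃[ y ] x * y ≡ a mod p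
∃-solution {p@(suc (suc m))} {x} p-prime p∤x a = a * x ^ m , (begin
  x * (a * x ^ m)   ≡⟨ swap x a (x ^ m) ⟩
  a * x ^ suc m     ≈⟨ *-congˡ-mod a (fermat-little p-prime p∤x) ⟩
  a * + 1           ≡⟨ ℤₚ.*-identityʳ a ⟩
  a                 ∎)
  where
  open import Relation.Binary.Reasoning.Setoid (≡-mod-setoid p)
  swap : ∀ x a y → x * (a * y) ≡ a * (x * y)
  swap = solve-∀

infix 4 _≢_mod_
_≢_mod_ : ℤ → ℤ → ℕ → Set
x ≢ y mod n = ¬ x ≡ y mod n

product : List ℤ → ℤ
product = foldr _*_ (+ 1)

product-∷ʳ : ∀ xs x → product (xs ∷ʳ x) ≡ product xs * x
product-∷ʳ []       x = ℤₚ.*-comm x (+ 1)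
product-∷ʳ (y ∷ xs) x = ≡.trans (cong (y *_) (product-∷ʳ xs x)) (≡.sym (ℤₚ.*-assoc y _ x))

module _ {A : Set} where

  ∈-─⁻ : ∀ {x y : A} {xs} (y∈xs : y ∈ xs) → x ∈ (xs ─ y∈xs) → x ∈ xs
  ∈-─⁻ (here _)   x∈        = there x∈
  ∈-─⁻ (there y∈) (here e)  = here e
  ∈-─⁻ (there y∈) (there x∈) = there (∈-─⁻ y∈ x∈)

  ∈-─⁺ : ∀ {x y : A} {xs} (y∈xs : y ∈ xs) → x ∈ xs → x ≢ y → x ∈ (xs ─ y∈xs)
  ∈-─⁺ (here refl) (here refl) x≢y = contradiction refl x≢y
  ∈-─⁺ (here _)    (there x∈)  _   = x∈
  ∈-─⁺ (there _)   (here e)    _   = here e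
  ∈-─⁺ (there y∈)  (there x∈)  x≢y = there (∈-─⁺ y∈ x∈ x≢y)

  module _ {ℓ} {R : Rel A ℓ} where

    AllPairs-─⁺ : ∀ {y xs} (y∈xs : y ∈ xs) → AllPairs R xs → AllPairs R (xs ─ y∈xs)
    AllPairs-─⁺ (here _)   (_ ∷ Rxs)  = Rxs
    AllPairs-─⁺ (there y∈) (Rx ∷ Rxs) = Allₚ.─⁺ y∈ Rx ∷ AllPairs-─⁺ y∈ Rxs

    AllPairs-─⇒related : ∀ {x y xs} (y∈xs : y ∈ xs) → AllPairs R xs → x ∈ (xs ─ y∈xs) → R y x ⊎ R x y
    AllPairs-─⇒related (here refl) (Ry ∷ _)  x∈          = inj₁ (All.lookup Ry x∈)
    AllPairs-─⇒related (there y∈)  (Rx ∷ _)  (here refl) = inj₂ (All.lookup Rx y∈)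
    AllPairs-─⇒related (there y∈)  (_ ∷ Rxs) (there x∈)  = AllPairs-─⇒related y∈ Rxs x∈

product-─ : ∀ {y} xs (y∈xs : y ∈ xs) → product xs ≡ y * product (xs ─ y∈xs)
product-─ (x ∷ xs) (here refl) = refl
product-─ {y} (x ∷ xs) (there y∈) = ≡.trans (cong (x *_) (product-─ xs y∈)) (swap x y (product (xs ─ y∈)))
  where swap : ∀ x y z → x * (y * z) ≡ y * (x * z)
        swap = solve-∀

module _ {p : ℕ} (p-prime : Prime p) {a : ℤ} (p∤a : ¬ + p ∣ a) where

  private
    Partnered : List ℤ → Set
    Partnered xs = ∀ {x} → x ∈ xs → ∃[ y ] y ∈ xs × (x * y ≡ a mod p)

    partner-unique : ∀ x y z → x * y ≡ a mod p → x * z ≡ a mod p → y ≡ z mod p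
    partner-unique x y z xy≡a xz≡a = *-cancelˡ-mod p-prime p∤x (≡-mod-trans xy≡a (≡-mod-sym xz≡a))
      where
      p∤x : ¬ + p ∣ x
      p∤x p∣x = p∤a (≡-mod-0⇒∣ (≡-mod-trans (≡-mod-sym xy≡a) (∣⇒≡-mod-0 (∣m⇒∣m*n y p∣x))))

    partnered-─ : ∀ {x y xs} → AllPairs (_≢_mod p) (x ∷ xs) → Partnered (x ∷ xs) →
                  (y∈xs : y ∈ xs) → x * y ≡ a mod p → Partnered (xs ─ y∈xs)
    partnered-─ {x} {y} (x≢xs ∷ distinct) partner y∈xs xy≡a {z} z∈ with partner (there (∈-─⁻ y∈xs z∈))
    ... | w , here refl , zx≡a =
      contradiction (partner-unique x y z xy≡a (≡-mod-trans (≡-mod-reflexive (ℤₚ.*-comm x z)) zx≡a))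
                    (Sum.[ id , _∘ ≡-mod-sym ] (AllPairs-─⇒related y∈xs distinct z∈))
    ... | w , there w∈xs , zw≡a = w , ∈-─⁺ y∈xs w∈xs w≢y , zw≡a
      where
      w≢y : w ≢ y
      w≢y refl = All.lookup x≢xs (∈-─⁻ y∈xs z∈)
        (partner-unique y x z (≡-mod-trans (≡-mod-reflexive (ℤₚ.*-comm y x)) xy≡a)
                              (≡-mod-trans (≡-mod-reflexive (ℤₚ.*-comm y z)) zw≡a))

    pair-off : ∀ xs → Acc _<_ (length xs) → AllPairs (_≢_mod p) xs → Partnered xs → (∀ {x} → x ∈ xs → x * x ≢ a mod p) →
               ∃[ k ] length xs ≡ k ℕ.* 2 × (product xs ≡ a ^ k mod p)
    pair-off [] _ _ _ _ = 0 , refl , ≡-mod-refl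
    pair-off (x ∷ xs) (acc smaller) distinct@(_ ∷ distinct′) partner no-root with partner (here refl)
    ... | y , here refl , x²≡a = contradiction x²≡a (no-root (here refl))
    ... | y , there y∈xs , xy≡a
      with pair-off (xs ─ y∈xs) (smaller shorter) (AllPairs-─⁺ y∈xs distinct′) (partnered-─ distinct partner y∈xs xy≡a)
                    (no-root ∘ there ∘ ∈-─⁻ y∈xs)
      where
      shorter : length (xs ─ y∈xs) < length (x ∷ xs)
      shorter = ℕₚ.≤-trans (ℕₚ.≤-reflexive (≡.sym (Listₚ.length-removeAt′ xs (index y∈xs)))) (ℕₚ.n≤1+n _)
    ... | k , length≡ , product≡ =
      suc k , cong suc (≡.trans (Listₚ.length-removeAt′ xs (index y∈xs)) (cong suc length≡)) , (begin
      x * product xs                      ≡⟨ cong (x *_) (product-─ xs y∈xs) ⟩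
      x * (y * product (xs ─ y∈xs))       ≡⟨ ℤₚ.*-assoc x y _ ⟨
      x * y * product (xs ─ y∈xs)         ≈⟨ *-cong-mod xy≡a product≡ ⟩
      a * a ^ k                           ∎)
      where open import Relation.Binary.Reasoning.Setoid (≡-mod-setoid p)

  product-of-pairs : ∀ xs → AllPairs (_≢_mod p) xs →
                     (∀ {x} → x ∈ xs → ∃[ y ] y ∈ xs × (x * y ≡ a mod p)) →
                     (∀ {x} → x ∈ xs → x * x ≢ a mod p) →
                     ∃[ k ] length xs ≡ k ℕ.* 2 × (product xs ≡ a ^ k mod p)
  product-of-pairs xs = pair-off xs (<-wellFounded (length xs))

range : ℕ → ℕ → List ℤ
range lo n = applyUpTo (λ i → + (lo ℕ.+ i)) n

∈-range⁺ : ∀ {lo n c} → lo ≤ c → c < lo ℕ.+ n → + c ∈ range lo n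
∈-range⁺ {lo} {n} lo≤c c<lo+n with ℕₚ.m≤n⇒∃[o]m+o≡n lo≤c
... | i , refl = ∈-applyUpTo⁺ (λ i → + (lo ℕ.+ i)) (ℕₚ.+-cancelˡ-< lo i n c<lo+n)

∈-range-elim : ∀ {ℓ} (P : ℤ → Set ℓ) {lo n} → (∀ {c} → lo ≤ c → c < lo ℕ.+ n → P (+ c)) → ∀ {x} → x ∈ range lo n → P x
∈-range-elim P {lo} f x∈ with ∈-applyUpTo⁻ (λ i → + (lo ℕ.+ i)) x∈
... | i , i<n , refl = f (ℕₚ.m≤m+n lo i) (ℕₚ.+-monoʳ-< lo i<n)

range-distinct : ∀ {lo n} → lo ℕ.+ n ≤ p → AllPairs (_≢_mod p) (range lo n)
range-distinct {p} {lo} {n} lo+n≤p = AllPairsₚ.applyUpTo⁺₁ _ n λ {i} {j} i<j j<n i≡j →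
  ℕₚ.<-irrefl (ℕₚ.+-cancelˡ-≡ lo i j (+-injective-mod (below (ℕₚ.<-trans i<j j<n)) (below j<n) i≡j)) i<j
  where
  below : ∀ {i} → i < n → lo ℕ.+ i < p
  below i<n = ℕₚ.<-≤-trans (ℕₚ.+-monoʳ-< lo i<n) lo+n≤p

∤-nonzero-residue : ∀ {c} → 0 < c → c < p → ¬ + p ∣ + c
∤-nonzero-residue 0<c c<p p∣c =
  ℕₚ.<-irrefl (≡.sym (+-injective-mod c<p (ℕₚ.≤-<-trans z≤n c<p) (∣⇒≡-mod-0 p∣c))) 0<c

residue-partner : Prime p → ∀ {a c} → ¬ + p ∣ a → 0 < c → c < p → ∃[ r ] 0 < r × r < p × (+ c * + r ≡ a mod p)
residue-partner {p} p-prime {a} {c} p∤a 0<c c<p =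
  nonzero (t ℤ.%ℕ p) (n%ℕd<d t p) (≡-mod-trans (*-congˡ-mod (+ c) (%ℕ-≡-mod t p)) ct≡a)
  where
  instance _ = prime⇒nonZero p-prime
  solution = ∃-solution p-prime (∤-nonzero-residue 0<c c<p) a
  t = proj₁ solution
  ct≡a = proj₂ solution
  nonzero : ∀ r → r < p → + c * + r ≡ a mod p → ∃[ r ] 0 < r × r < p × (+ c * + r ≡ a mod p)
  nonzero zero    _   c*0≡a = contradiction (≡-mod-0⇒∣ (≡-mod-trans (≡-mod-sym c*0≡a) (≡-mod-reflexive (ℤₚ.*-zeroʳ (+ c))))) p∤a
  nonzero (suc r) r<p cr≡a  = suc r , s≤s z≤n , r<p , cr≡a

module _ {m : ℕ} where
  private
    p′ = 3 ℕ.+ m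

  interior≢±1 : ∀ {c} → 2 ≤ c → c < 2 ℕ.+ m → + c ≡ + 1 mod p′ ⊎ + c ≡ - + 1 mod p′ → ⊥
  interior≢±1 2≤c c<2+m (inj₁ c≡1) =
    ℕₚ.<-irrefl (+-injective-mod (s≤s (s≤s z≤n)) (ℕₚ.<-trans c<2+m (ℕₚ.n<1+n _)) (≡-mod-sym c≡1)) 2≤c
  interior≢±1 2≤c c<2+m (inj₂ c≡-1) =
    ℕₚ.<-irrefl (+-injective-mod (ℕₚ.<-trans c<2+m (ℕₚ.n<1+n _)) (ℕₚ.n<1+n _) (≡-mod-trans c≡-1 (-1≡n-mod-1+n (2 ℕ.+ m)))) c<2+m

  interior-inverse : Prime p′ → ∀ {c} → 2 ≤ c → c < 2 ℕ.+ m → ∃[ r ] 2 ≤ r × r < 2 ℕ.+ m × (+ c * + r ≡ + 1 mod p′)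
  interior-inverse p′-prime {c} 2≤c c<2+m = narrow (residue-partner p′-prime (∤-nonzero-residue (s≤s z≤n) (s≤s (s≤s z≤n)))
                                                     (ℕₚ.<-trans (s≤s z≤n) 2≤c) (ℕₚ.<-trans c<2+m (ℕₚ.n<1+n _)))
    where
    narrow : ∃[ r ] 0 < r × r < p′ × (+ c * + r ≡ + 1 mod p′) → ∃[ r ] 2 ≤ r × r < 2 ℕ.+ m × (+ c * + r ≡ + 1 mod p′)
    narrow (zero , () , _)
    narrow (suc zero , _ , _ , c*1≡1) =
      ⊥-elim (interior≢±1 2≤c c<2+m (inj₁ (≡-mod-trans (≡-mod-reflexive (≡.sym (ℤₚ.*-identityʳ (+ c)))) c*1≡1)))
    narrow (suc (suc r) , _ , r<p′ , cr≡1) = suc (suc r) , s≤s (s≤s z≤n) , ℕₚ.≤∧≢⇒< (ℕₚ.≤-pred r<p′) r≢2+m , cr≡1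
      where
      r≢2+m : suc (suc r) ≢ 2 ℕ.+ m
      r≢2+m refl = interior≢±1 2≤c c<2+m (inj₂ (begin
        + c                        ≡⟨ ℤₚ.neg-involutive (+ c) ⟨
        - - + c                    ≡⟨ cong -_ (negate (+ c)) ⟩
        - (+ c * - + 1)            ≈⟨ -‿cong-mod (*-congˡ-mod (+ c) (-1≡n-mod-1+n (2 ℕ.+ m))) ⟩
        - (+ c * + (2 ℕ.+ m))      ≈⟨ -‿cong-mod cr≡1 ⟩
        - + 1                      ∎))
        where
        open import Relation.Binary.Reasoning.Setoid (≡-mod-setoid p′)
        negate : ∀ x → - x ≡ x * - + 1
        negate = solve-∀

-- The residues 2, …, p − 2 split into pairs of mutual inverses, leaving 1 · (p − 1) ≡ −1.
wilson : Prime p → product (range 1 (ℕ.pred p)) ≡ - + 1 mod p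
wilson {suc (suc zero)} _ = congruent (divides (+ 1) refl)
wilson {p@(suc (suc (suc m)))} p-prime = begin
  + 1 * product (range 2 (suc m))             ≡⟨ cong (λ xs → + 1 * product xs) (Listₚ.applyUpTo-∷ʳ (λ i → + (2 ℕ.+ i)) m) ⟨
  + 1 * product (range 2 m ∷ʳ + (2 ℕ.+ m))    ≡⟨ cong (+ 1 *_) (product-∷ʳ (range 2 m) _) ⟩
  + 1 * (product (range 2 m) * + (2 ℕ.+ m))   ≈⟨ *-congˡ-mod (+ 1) (*-cong-mod product≡1ᵏ (≡-mod-sym (-1≡n-mod-1+n (2 ℕ.+ m)))) ⟩
  + 1 * ((+ 1) ^ k * - + 1)                   ≡⟨ cong (λ z → + 1 * (z * - + 1)) (ℤₚ.^-zeroˡ k) ⟩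
  - + 1                                       ∎
  where
  open import Relation.Binary.Reasoning.Setoid (≡-mod-setoid p)

  partner : ∀ {x} → x ∈ range 2 m → ∃[ y ] y ∈ range 2 m × (x * y ≡ + 1 mod p)
  partner = ∈-range-elim (λ x → ∃[ y ] y ∈ range 2 m × (x * y ≡ + 1 mod p))
    (λ 2≤c c<2+m → case interior-inverse p-prime 2≤c c<2+m of λ where
      (r , 2≤r , r<2+m , cr≡1) → + r , ∈-range⁺ 2≤r r<2+m , cr≡1)

  no-root : ∀ {x} → x ∈ range 2 m → x * x ≢ + 1 mod p
  no-root = ∈-range-elim (λ x → x * x ≢ + 1 mod p)
    (λ 2≤c c<2+m c²≡1 → interior≢±1 2≤c c<2+m (x²≡1⇒x≡±1 p-prime c²≡1))

  pairing = product-of-pairs p-prime (∤-nonzero-residue (s≤s z≤n) (s≤s (s≤s z≤n))) (range 2 m)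
              (range-distinct (ℕₚ.n≤1+n _)) partner no-root
  k = proj₁ pairing
  product≡1ᵏ = proj₂ (proj₂ pairing)

2-prime : Prime 2
2-prime = toWitness {a? = prime? 2} _

[x*x]^k≡x^[k*2] : ∀ x k → (x * x) ^ k ≡ x ^ (k ℕ.* 2)
[x*x]^k≡x^[k*2] x zero    = refl
[x*x]^k≡x^[k*2] x (suc k) = ≡.trans (cong ((x * x) *_) ([x*x]^k≡x^[k*2] x k)) (ℤₚ.*-assoc x x _)

^-distribʳ-* : ∀ x y k → (x * y) ^ k ≡ x ^ k * y ^ k
^-distribʳ-* x y zero    = refl
^-distribʳ-* x y (suc k) = ≡.trans (cong ((x * y) *_) (^-distribʳ-* x y k)) (interchange x y (x ^ k) (y ^ k))
  where interchange : ∀ x y z w → (x * y) * (z * w) ≡ (x * z) * (y * w)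
        interchange = solve-∀

module _ {p : ℕ} (p-prime : Prime p) (p≢2 : p ≢ 2) where

  private
    instance _ = prime⇒nonZero p-prime
    e = p / 2

  pred≡[p/2]*2 : ℕ.pred p ≡ p / 2 ℕ.* 2
  pred≡[p/2]*2 = ℕₚ.suc-injective (≡.trans (ℕₚ.suc-pred p) (≡.trans (m≡m%n+[m/n]*n p 2) (cong (ℕ._+ e ℕ.* 2) p%2≡1)))
    where
    p%2≡1 : p % 2 ≡ 1
    p%2≡1 with p % 2 | m%n<n p 2 | ℕᵈ.m%n≡0⇒n∣m p 2
    ... | zero        | _            | 2∣p = contradiction (≡.sym (prime∣prime⇒≡ 2-prime p-prime (2∣p refl))) p≢2
    ... | suc zero    | _            | _   = refl
    ... | suc (suc _) | s≤s (s≤s ()) | _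

  1≢-1 : + 1 ≢ - + 1 mod p
  1≢-1 (congruent p∣2) = p≢2 (prime∣prime⇒≡ p-prime 2-prime (∣⇒∣ᵤ p∣2))

  euler-residue : ¬ + p ∣ y → (y * y) ^ (p / 2) ≡ + 1 mod p
  euler-residue {y = y} p∤y =
    ≡-mod-trans (≡-mod-reflexive (≡.trans ([x*x]^k≡x^[k*2] y e) (cong (y ^_) (≡.sym pred≡[p/2]*2)))) (fermat-little p-prime p∤y)

  euler-nonresidue : ∀ {a} → ¬ + p ∣ a → (∀ y → y * y ≢ a mod p) → a ^ (p / 2) ≡ - + 1 mod p
  euler-nonresidue {a} p∤a no-root = begin
    a ^ e                          ≡⟨ cong (a ^_) k≡e ⟨
    a ^ k                          ≈⟨ product≡aᵏ ⟨
    product (range 1 (ℕ.pred p))   ≈⟨ wilson p-prime ⟩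
    - + 1                          ∎
    where
    open import Relation.Binary.Reasoning.Setoid (≡-mod-setoid p)

    partner : ∀ {x} → x ∈ range 1 (ℕ.pred p) → ∃[ y ] y ∈ range 1 (ℕ.pred p) × (x * y ≡ a mod p)
    partner = ∈-range-elim (λ x → ∃[ y ] y ∈ range 1 (ℕ.pred p) × (x * y ≡ a mod p))
      (λ 0<c c<p → case residue-partner p-prime p∤a 0<c (≡.subst (_ <_) (ℕₚ.suc-pred p) c<p) of λ where
        (r , 0<r , r<p , cr≡a) → + r , ∈-range⁺ 0<r (≡.subst (r <_) (≡.sym (ℕₚ.suc-pred p)) r<p) , cr≡a)

    pairing = product-of-pairs p-prime p∤a (range 1 (ℕ.pred p)) (range-distinct (ℕₚ.≤-reflexive (ℕₚ.suc-pred p)))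
                partner (λ {x} _ → no-root x)
    k = proj₁ pairing
    product≡aᵏ = proj₂ (proj₂ pairing)

    k≡e : k ≡ e
    k≡e = ℕₚ.*-cancelʳ-≡ k e 2
      (≡.trans (≡.sym (proj₁ (proj₂ pairing))) (≡.trans (Listₚ.length-applyUpTo _ (ℕ.pred p)) pred≡[p/2]*2))

  x*d≡s²⇒x^[p/2]≡d^[p/2] : ∀ {x d s χ} → ¬ + p ∣ s → x * d ≡ s * s mod p →
                           χ * χ ≡ + 1 → d ^ (p / 2) ≡ χ mod p → x ^ (p / 2) ≡ χ mod p
  x*d≡s²⇒x^[p/2]≡d^[p/2] {x} {d} {s} {χ} p∤s xd≡s² χ²≡1 dᵉ≡χ = begin
    x ^ e                  ≡⟨ ℤₚ.*-identityʳ (x ^ e) ⟨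
    x ^ e * + 1            ≡⟨ cong (x ^ e *_) χ²≡1 ⟨
    x ^ e * (χ * χ)        ≈⟨ *-congˡ-mod (x ^ e) (*-congʳ-mod χ dᵉ≡χ) ⟨
    x ^ e * (d ^ e * χ)    ≡⟨ ℤₚ.*-assoc (x ^ e) (d ^ e) χ ⟨
    x ^ e * d ^ e * χ      ≡⟨ cong (_* χ) (^-distribʳ-* x d e) ⟨
    (x * d) ^ e * χ        ≈⟨ *-congʳ-mod χ (^-cong-mod e xd≡s²) ⟩
    (s * s) ^ e * χ        ≈⟨ *-congʳ-mod χ (euler-residue p∤s) ⟩
    + 1 * χ                ≡⟨ ℤₚ.*-identityˡ χ ⟩
    χ                      ∎
    where open import Relation.Binary.Reasoning.Setoid (≡-mod-setoid p)

  private
    square-root-below : ∀ {a} y → y * y ≡ a mod p → Any.Any (λ r → + p ∣ (+ r * + r - a)) (upTo p)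
    square-root-below y y²≡a =
      Any.map (λ { refl → modulus∣difference (≡-mod-trans (*-cong-mod r≡y r≡y) y²≡a) }) (∈-upTo⁺ (n%ℕd<d y p))
      where r≡y = %ℕ-≡-mod y p

  x^[p/2]≡1⇒legendre≡1 : ¬ + p ∣ x → x ^ (p / 2) ≡ + 1 mod p → legendre x p ≡ + 1
  x^[p/2]≡1⇒legendre≡1 {x} p∤x xᵉ≡1 with + p ∣? x
  ... | yes p∣x = contradiction p∣x p∤x
  ... | no _ with any? (λ r → + p ∣? (+ r * + r - x)) (upTo p)
  ...   | yes _      = refl
  ...   | no no-root = contradiction
    (≡-mod-trans (≡-mod-sym xᵉ≡1) (euler-nonresidue p∤x λ y y²≡x → no-root (square-root-below y y²≡x))) 1≢-1

  x^[p/2]≡-1⇒legendre≡-1 : ¬ + p ∣ x → x ^ (p / 2) ≡ - + 1 mod p → legendre x p ≡ -[1+ 0 ]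
  x^[p/2]≡-1⇒legendre≡-1 {x} p∤x xᵉ≡-1 with + p ∣? x
  ... | yes p∣x = contradiction p∣x p∤x
  ... | no _ with any? (λ r → + p ∣? (+ r * + r - x)) (upTo p)
  ...   | no _     = refl
  ...   | yes root = ⊥-elim (no-square-root (Any.satisfied root))
    where
    no-square-root : ¬ (∃[ r ] + p ∣ (+ r * + r - x))
    no-square-root (r , p∣r²-x) = 1≢-1
      (≡-mod-trans (≡-mod-sym (euler-residue p∤r)) (≡-mod-trans (^-cong-mod e (congruent p∣r²-x)) xᵉ≡-1))
      where
      p∤r : ¬ + p ∣ + r
      p∤r p∣r = p∤x (≡-mod-0⇒∣ (≡-mod-trans (≡-mod-sym (congruent p∣r²-x)) (∣⇒≡-mod-0 (∣m⇒∣m*n (+ r) p∣r))))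

-- ⟨ x₀ , x₁ ⟩ stands for x₀ + x₁Y in ℤ[Y]/(Y² − uY + w), and elements are compared coefficientwise
-- modulo n.  Ȳ = u − Y is the conjugate of Y.
module QuadraticExtension (n : ℕ) (u w : ℤ) where

  record Quad : Set where
    constructor ⟨_,_⟩
    field coeff₀ coeff₁ : ℤ
  open Quad

  infixl 6 _⊕_
  infixl 7 _⊗_
  infix 4 _≋_

  _⊕_ : Quad → Quad → Quad
  ⟨ x₀ , x₁ ⟩ ⊕ ⟨ z₀ , z₁ ⟩ = ⟨ x₀ + z₀ , x₁ + z₁ ⟩

  _⊗_ : Quad → Quad → Quad
  ⟨ x₀ , x₁ ⟩ ⊗ ⟨ z₀ , z₁ ⟩ = ⟨ x₀ * z₀ - x₁ * z₁ * w , x₀ * z₁ + x₁ * z₀ + x₁ * z₁ * u ⟩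

  record _≋_ (X Z : Quad) : Set where
    constructor _,_
    field
      coeff₀≡ : coeff₀ X ≡ coeff₀ Z mod n
      coeff₁≡ : coeff₁ X ≡ coeff₁ Z mod n
  open _≋_

  ≋-reflexive : ∀ {X Z} → X ≡ Z → X ≋ Z
  ≋-reflexive refl = ≡-mod-refl , ≡-mod-refl

  private
    ⟨⟩-≡ : ∀ {x₀ x₁ z₀ z₁} → x₀ ≡ z₀ → x₁ ≡ z₁ → ⟨ x₀ , x₁ ⟩ ≡ ⟨ z₀ , z₁ ⟩
    ⟨⟩-≡ = cong₂ ⟨_,_⟩

  ≋-isEquivalence : IsEquivalence _≋_
  ≋-isEquivalence = record
    { refl  = ≡-mod-refl , ≡-mod-refl
    ; sym   = λ (x₀≡ , x₁≡) → ≡-mod-sym x₀≡ , ≡-mod-sym x₁≡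
    ; trans = λ (x₀≡ , x₁≡) (y₀≡ , y₁≡) → ≡-mod-trans x₀≡ y₀≡ , ≡-mod-trans x₁≡ y₁≡ }

  ⊕-cong : ∀ {X X′ Z Z′} → X ≋ X′ → Z ≋ Z′ → X ⊕ Z ≋ X′ ⊕ Z′
  ⊕-cong {⟨ _ , _ ⟩} {⟨ _ , _ ⟩} {⟨ _ , _ ⟩} {⟨ _ , _ ⟩} (x₀≡ , x₁≡) (z₀≡ , z₁≡) =
    +-cong-mod x₀≡ z₀≡ , +-cong-mod x₁≡ z₁≡

  ⊗-cong : ∀ {X X′ Z Z′} → X ≋ X′ → Z ≋ Z′ → X ⊗ Z ≋ X′ ⊗ Z′
  ⊗-cong {⟨ _ , _ ⟩} {⟨ _ , _ ⟩} {⟨ _ , _ ⟩} {⟨ _ , _ ⟩} (x₀≡ , x₁≡) (z₀≡ , z₁≡) =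
    +-cong-mod (*-cong-mod x₀≡ z₀≡) (-‿cong-mod (*-congʳ-mod w (*-cong-mod x₁≡ z₁≡))) ,
    +-cong-mod (+-cong-mod (*-cong-mod x₀≡ z₁≡) (*-cong-mod x₁≡ z₀≡)) (*-congʳ-mod u (*-cong-mod x₁≡ z₁≡))

  private
    ⊕-assoc : ∀ X Y Z → (X ⊕ Y) ⊕ Z ≡ X ⊕ (Y ⊕ Z)
    ⊕-assoc ⟨ x₀ , x₁ ⟩ ⟨ y₀ , y₁ ⟩ ⟨ z₀ , z₁ ⟩ = ⟨⟩-≡ (ℤₚ.+-assoc x₀ y₀ z₀) (ℤₚ.+-assoc x₁ y₁ z₁)

    ⊕-comm : ∀ X Z → X ⊕ Z ≡ Z ⊕ X
    ⊕-comm ⟨ x₀ , x₁ ⟩ ⟨ z₀ , z₁ ⟩ = ⟨⟩-≡ (ℤₚ.+-comm x₀ z₀) (ℤₚ.+-comm x₁ z₁)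

    ⊕-identityˡ : ∀ X → ⟨ + 0 , + 0 ⟩ ⊕ X ≡ X
    ⊕-identityˡ ⟨ x₀ , x₁ ⟩ = ⟨⟩-≡ (ℤₚ.+-identityˡ x₀) (ℤₚ.+-identityˡ x₁)

    ⊗-assoc : ∀ X Y Z → (X ⊗ Y) ⊗ Z ≡ X ⊗ (Y ⊗ Z)
    ⊗-assoc ⟨ x₀ , x₁ ⟩ ⟨ y₀ , y₁ ⟩ ⟨ z₀ , z₁ ⟩ = ⟨⟩-≡ (lemma₀ x₀ x₁ y₀ y₁ z₀ z₁ u w) (lemma₁ x₀ x₁ y₀ y₁ z₀ z₁ u w)
      where
      lemma₀ : ∀ x₀ x₁ y₀ y₁ z₀ z₁ u w →
        (x₀ * y₀ - x₁ * y₁ * w) * z₀ - (x₀ * y₁ + x₁ * y₀ + x₁ * y₁ * u) * z₁ * w ≡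
        x₀ * (y₀ * z₀ - y₁ * z₁ * w) - x₁ * (y₀ * z₁ + y₁ * z₀ + y₁ * z₁ * u) * w
      lemma₀ = solve-∀
      lemma₁ : ∀ x₀ x₁ y₀ y₁ z₀ z₁ u w →
        (x₀ * y₀ - x₁ * y₁ * w) * z₁ + (x₀ * y₁ + x₁ * y₀ + x₁ * y₁ * u) * z₀ + (x₀ * y₁ + x₁ * y₀ + x₁ * y₁ * u) * z₁ * u ≡
        x₀ * (y₀ * z₁ + y₁ * z₀ + y₁ * z₁ * u) + x₁ * (y₀ * z₀ - y₁ * z₁ * w) + x₁ * (y₀ * z₁ + y₁ * z₀ + y₁ * z₁ * u) * u
      lemma₁ = solve-∀

    ⊗-comm : ∀ X Z → X ⊗ Z ≡ Z ⊗ X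
    ⊗-comm ⟨ x₀ , x₁ ⟩ ⟨ z₀ , z₁ ⟩ = ⟨⟩-≡ (lemma₀ x₀ x₁ z₀ z₁ w) (lemma₁ x₀ x₁ z₀ z₁ u)
      where
      lemma₀ : ∀ x₀ x₁ z₀ z₁ w → x₀ * z₀ - x₁ * z₁ * w ≡ z₀ * x₀ - z₁ * x₁ * w
      lemma₀ = solve-∀
      lemma₁ : ∀ x₀ x₁ z₀ z₁ u → x₀ * z₁ + x₁ * z₀ + x₁ * z₁ * u ≡ z₀ * x₁ + z₁ * x₀ + z₁ * x₁ * u
      lemma₁ = solve-∀

    ⊗-identityˡ : ∀ X → ⟨ + 1 , + 0 ⟩ ⊗ X ≡ X
    ⊗-identityˡ ⟨ x₀ , x₁ ⟩ = ⟨⟩-≡ (lemma₀ x₀ x₁ w) (lemma₁ x₀ x₁ u)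
      where
      lemma₀ : ∀ x₀ x₁ w → + 1 * x₀ - + 0 * x₁ * w ≡ x₀
      lemma₀ = solve-∀
      lemma₁ : ∀ x₀ x₁ u → + 1 * x₁ + + 0 * x₀ + + 0 * x₁ * u ≡ x₁
      lemma₁ = solve-∀

    ⊗-distribʳ-⊕ : ∀ X Y Z → (Y ⊕ Z) ⊗ X ≡ Y ⊗ X ⊕ Z ⊗ X
    ⊗-distribʳ-⊕ ⟨ x₀ , x₁ ⟩ ⟨ y₀ , y₁ ⟩ ⟨ z₀ , z₁ ⟩ = ⟨⟩-≡ (lemma₀ x₀ x₁ y₀ y₁ z₀ z₁ w) (lemma₁ x₀ x₁ y₀ y₁ z₀ z₁ u)
      where
      lemma₀ : ∀ x₀ x₁ y₀ y₁ z₀ z₁ w → (y₀ + z₀) * x₀ - (y₁ + z₁) * x₁ * w ≡ (y₀ * x₀ - y₁ * x₁ * w) + (z₀ * x₀ - z₁ * x₁ * w)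
      lemma₀ = solve-∀
      lemma₁ : ∀ x₀ x₁ y₀ y₁ z₀ z₁ u → (y₀ + z₀) * x₁ + (y₁ + z₁) * x₀ + (y₁ + z₁) * x₁ * u ≡
                                       (y₀ * x₁ + y₁ * x₀ + y₁ * x₁ * u) + (z₀ * x₁ + z₁ * x₀ + z₁ * x₁ * u)
      lemma₁ = solve-∀

    ⊗-zeroˡ : ∀ X → ⟨ + 0 , + 0 ⟩ ⊗ X ≡ ⟨ + 0 , + 0 ⟩
    ⊗-zeroˡ ⟨ x₀ , x₁ ⟩ = ⟨⟩-≡ (lemma₀ x₀ x₁ w) (lemma₁ x₀ x₁ u)
      where
      lemma₀ : ∀ x₀ x₁ w → + 0 * x₀ - + 0 * x₁ * w ≡ + 0
      lemma₀ = solve-∀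
      lemma₁ : ∀ x₀ x₁ u → + 0 * x₁ + + 0 * x₀ + + 0 * x₁ * u ≡ + 0
      lemma₁ = solve-∀

  commutativeSemiring : CommutativeSemiring 0ℓ 0ℓ
  commutativeSemiring = record
    { _≈_ = _≋_ ; _+_ = _⊕_ ; _*_ = _⊗_ ; 0# = ⟨ + 0 , + 0 ⟩ ; 1# = ⟨ + 1 , + 0 ⟩
    ; isCommutativeSemiring = isCommutativeSemiring-from-≡-laws ≋-isEquivalence ⊕-cong ⊗-cong
        ⊕-assoc ⊕-comm ⊕-identityˡ ⊗-assoc ⊗-comm ⊗-identityˡ ⊗-distribʳ-⊕ ⊗-zeroˡ }

  open CommutativeSemiring commutativeSemiring
    using (setoid; semiring; +-monoid; *-identityʳ; *-comm; *-assoc)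
    renaming (refl to ≋-refl; sym to ≋-sym; trans to ≋-trans)
  open import Algebra.Properties.Semiring.Exp semiring public using () renaming (_^_ to _^ᵠ_)
  open import Algebra.Properties.Semiring.Exp semiring using (^-congˡ; ^-congʳ; ^-homo-*; ^-assocʳ)
  open import Algebra.Properties.Monoid.Mult +-monoid using () renaming (_×_ to _·_)

  ι : ℤ → Quad
  ι c = ⟨ c , + 0 ⟩

  Y Ȳ : Quad
  Y = ⟨ + 0 , + 1 ⟩
  Ȳ = ⟨ u , - + 1 ⟩

  ι-cong : ∀ {x y} → x ≡ y mod n → ι x ≋ ι y
  ι-cong x≡y = x≡y , ≡-mod-refl

  ι-⊗ : ∀ x y → ι x ⊗ ι y ≡ ι (x * y)
  ι-⊗ x y = ⟨⟩-≡ (lemma₀ x y w) (lemma₁ x y u)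
    where
    lemma₀ : ∀ x y w → x * y - + 0 * + 0 * w ≡ x * y
    lemma₀ = solve-∀
    lemma₁ : ∀ x y u → x * + 0 + + 0 * y + + 0 * + 0 * u ≡ + 0
    lemma₁ = solve-∀

  ι-^ᵠ : ∀ c k → ι c ^ᵠ k ≋ ι (c ^ k)
  ι-^ᵠ c zero    = ≋-refl
  ι-^ᵠ c (suc k) = ≋-trans (⊗-cong (≋-refl {ι c}) (ι-^ᵠ c k)) (≋-reflexive (ι-⊗ c (c ^ k)))

  ι⊗Ȳ : ∀ c → ι c ⊗ Ȳ ≡ ⟨ c * u , - c ⟩
  ι⊗Ȳ c = ⟨⟩-≡ (lemma₀ c u w) (lemma₁ c u)
    where
    lemma₀ : ∀ c u w → c * u - + 0 * - + 1 * w ≡ c * u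
    lemma₀ = solve-∀
    lemma₁ : ∀ c u → c * - + 1 + + 0 * u + + 0 * - + 1 * u ≡ - c
    lemma₁ = solve-∀

  Y⊗Ȳ≡ι : Y ⊗ Ȳ ≡ ι w
  Y⊗Ȳ≡ι = ⟨⟩-≡ (lemma₀ u w) (lemma₁ u)
    where
    lemma₀ : ∀ u w → + 0 * u - + 1 * - + 1 * w ≡ w
    lemma₀ = solve-∀
    lemma₁ : ∀ u → + 0 * - + 1 + + 1 * u + + 1 * - + 1 * u ≡ + 0
    lemma₁ = solve-∀

  lucas : ℕ → ℤ
  lucas zero          = + 0
  lucas (suc zero)    = + 1
  lucas (suc (suc k)) = u * lucas (suc k) - w * lucas k

  Y^[1+k]≡lucas : ∀ k → Y ^ᵠ suc k ≡ ⟨ - (w * lucas k) , lucas (suc k) ⟩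
  Y^[1+k]≡lucas zero    = ⟨⟩-≡ (lemma₀ u w) (lemma₁ u w)
    where
    lemma₀ : ∀ u w → + 0 * + 1 - + 1 * + 0 * w ≡ - (w * + 0)
    lemma₀ = solve-∀
    lemma₁ : ∀ u w → + 0 * + 0 + + 1 * + 1 + + 1 * + 0 * u ≡ + 1
    lemma₁ = solve-∀
  Y^[1+k]≡lucas (suc k) = ≡.trans (cong (Y ⊗_) (Y^[1+k]≡lucas k)) (⟨⟩-≡ (lemma₀ u w Uₖ Uₖ₊₁) (lemma₁ u w Uₖ Uₖ₊₁))
    where
    Uₖ = lucas k
    Uₖ₊₁ = lucas (suc k)
    lemma₀ : ∀ u w Uₖ Uₖ₊₁ → + 0 * - (w * Uₖ) - + 1 * Uₖ₊₁ * w ≡ - (w * Uₖ₊₁)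
    lemma₀ = solve-∀
    lemma₁ : ∀ u w Uₖ Uₖ₊₁ → + 0 * Uₖ₊₁ + + 1 * - (w * Uₖ) + + 1 * Uₖ₊₁ * u ≡ u * Uₖ₊₁ - w * Uₖ
    lemma₁ = solve-∀

  ·-char : ∀ X → n · X ≋ ⟨ + 0 , + 0 ⟩
  ·-char ⟨ x₀ , x₁ ⟩ = ≋-trans (≋-reflexive (·≡⟨*⟩ n)) (n∣n* x₀ , n∣n* x₁)
    where
    ·≡⟨*⟩ : ∀ k → k · ⟨ x₀ , x₁ ⟩ ≡ ⟨ + k * x₀ , + k * x₁ ⟩
    ·≡⟨*⟩ zero    = ⟨⟩-≡ (≡.sym (ℤₚ.*-zeroˡ x₀)) (≡.sym (ℤₚ.*-zeroˡ x₁))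
    ·≡⟨*⟩ (suc k) = ≡.trans (cong (⟨ x₀ , x₁ ⟩ ⊕_) (·≡⟨*⟩ k)) (⟨⟩-≡ (≡.sym (ℤₚ.suc-* (+ k) x₀)) (≡.sym (ℤₚ.suc-* (+ k) x₁)))
    n∣n* : ∀ x → + n * x ≡ + 0 mod n
    n∣n* x = ∣⇒≡-mod-0 (∣m⇒∣m*n x ∣-refl)

  discriminant : ℤ
  discriminant = u * u - + 4 * w

  δ : Quad
  δ = ⟨ - u , + 2 ⟩

  δ²≋discriminant : δ ^ᵠ 2 ≋ ι discriminant
  δ²≋discriminant = ≋-trans (⊗-cong (≋-refl {δ}) (*-identityʳ δ)) (≋-reflexive (⟨⟩-≡ (lemma₀ u w) (lemma₁ u)))
    where
    lemma₀ : ∀ u w → - u * - u - + 2 * + 2 * w ≡ u * u - + 4 * w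
    lemma₀ = solve-∀
    lemma₁ : ∀ u → - u * + 2 + + 2 * - u + + 2 * + 2 * u ≡ + 0
    lemma₁ = solve-∀

  module _ (n-prime : Prime n) (n≢2 : n ≢ 2) where

    private
      instance _ = prime⇒nonZero n-prime
      e = n / 2

    δ^n≋δ⊗discriminant^[n/2] : δ ^ᵠ n ≋ δ ⊗ ι (discriminant ^ (n / 2))
    δ^n≋δ⊗discriminant^[n/2] = begin
      δ ^ᵠ n                        ≡⟨ cong (δ ^ᵠ_) (≡.trans (≡.sym (ℕₚ.suc-pred n)) (cong suc (pred≡[p/2]*2 n-prime n≢2))) ⟩
      δ ⊗ δ ^ᵠ (e ℕ.* 2)            ≈⟨ ⊗-cong (≋-refl {δ}) (^-congʳ δ (ℕₚ.*-comm e 2)) ⟩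
      δ ⊗ δ ^ᵠ (2 ℕ.* e)            ≈⟨ ⊗-cong (≋-refl {δ}) (^-assocʳ δ 2 e) ⟨
      δ ⊗ (δ ^ᵠ 2) ^ᵠ e             ≈⟨ ⊗-cong (≋-refl {δ}) (^-congˡ e δ²≋discriminant) ⟩
      δ ⊗ ι discriminant ^ᵠ e       ≈⟨ ⊗-cong (≋-refl {δ}) (ι-^ᵠ discriminant e) ⟩
      δ ⊗ ι (discriminant ^ e)      ∎
      where open import Relation.Binary.Reasoning.Setoid setoid

    δ^n≋-u+2Y^n : δ ^ᵠ n ≋ ι (- u) ⊕ ι (+ 2) ⊗ Y ^ᵠ n
    δ^n≋-u+2Y^n = begin
      δ ^ᵠ n                                  ≡⟨ cong (_^ᵠ n) δ≡ ⟩
      (ι (- u) ⊕ ι (+ 2) ⊗ Y) ^ᵠ n            ≈⟨ Frobenius.frobenius commutativeSemiring n-prime ·-char (ι (- u)) (ι (+ 2) ⊗ Y) ⟩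
      ι (- u) ^ᵠ n ⊕ (ι (+ 2) ⊗ Y) ^ᵠ n       ≈⟨ ⊕-cong (ι-fermat (- u)) (^-distrib-* (ι (+ 2)) Y n) ⟩
      ι (- u) ⊕ ι (+ 2) ^ᵠ n ⊗ Y ^ᵠ n         ≈⟨ ⊕-cong (≋-refl {ι (- u)}) (⊗-cong (ι-fermat (+ 2)) (≋-refl {Y ^ᵠ n})) ⟩
      ι (- u) ⊕ ι (+ 2) ⊗ Y ^ᵠ n              ∎
      where
      open import Relation.Binary.Reasoning.Setoid setoid
      open import Algebra.Properties.CommutativeSemiring.Exp commutativeSemiring using (^-distrib-*)
      ι-fermat : ∀ c → ι c ^ᵠ n ≋ ι c
      ι-fermat c = ≋-trans (ι-^ᵠ c n) (ι-cong (fermat n-prime c))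
      δ≡ : δ ≡ ι (- u) ⊕ ι (+ 2) ⊗ Y
      δ≡ = ⟨⟩-≡ (lemma₀ u w) (lemma₁ u)
        where
        lemma₀ : ∀ u w → - u ≡ - u + (+ 2 * + 0 - + 0 * + 1 * w)
        lemma₀ = solve-∀
        lemma₁ : ∀ u → + 2 ≡ + 0 + (+ 2 * + 1 + + 0 * + 0 + + 0 * + 1 * u)
        lemma₁ = solve-∀

    -- Compare the Y-coefficients of the two expressions for δⁿ, where δ = 2Y − u.
    Y^n≋⇒discriminant^[n/2]≡coeff₁ : ∀ {Z} → Y ^ᵠ n ≋ Z → discriminant ^ (n / 2) ≡ coeff₁ Z mod n
    Y^n≋⇒discriminant^[n/2]≡coeff₁ {⟨ z₀ , z₁ ⟩} Y^n≋Z = *-cancelˡ-mod n-prime (λ n∣2 → 1≢-1 n-prime n≢2 (congruent n∣2)) (begin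
      + 2 * D                                          ≡⟨ lemma₀ u D ⟩
      coeff₁ (δ ⊗ ι D)                                 ≈⟨ coeff₁≡ δ⊗ι≋ ⟩
      coeff₁ (ι (- u) ⊕ ι (+ 2) ⊗ ⟨ z₀ , z₁ ⟩)         ≡⟨ lemma₁ u z₀ z₁ ⟨
      + 2 * z₁                                         ∎)
      where
      open import Relation.Binary.Reasoning.Setoid (≡-mod-setoid n)
      D = discriminant ^ e
      δ⊗ι≋ : δ ⊗ ι D ≋ ι (- u) ⊕ ι (+ 2) ⊗ ⟨ z₀ , z₁ ⟩
      δ⊗ι≋ = ≋-trans (≋-sym δ^n≋δ⊗discriminant^[n/2])
               (≋-trans δ^n≋-u+2Y^n (⊕-cong (≋-refl {ι (- u)}) (⊗-cong (≋-refl {ι (+ 2)}) Y^n≋Z)))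
      lemma₀ : ∀ u D → + 2 * D ≡ - u * + 0 + + 2 * D + + 2 * + 0 * u
      lemma₀ = solve-∀
      lemma₁ : ∀ u z₀ z₁ → + 2 * z₁ ≡ + 0 + (+ 2 * z₁ + + 0 * z₀ + + 0 * z₁ * u)
      lemma₁ = solve-∀

  module _ {c : ℤ} where

    Y⁶≋⇒Y⁷≋ : w ≡ c * c → Y ^ᵠ 6 ≋ ι (c ^ 5) ⊗ Ȳ → Y ^ᵠ 7 ≋ ι (c ^ 7)
    Y⁶≋⇒Y⁷≋ w≡c² Y⁶≋ = begin
      Y ⊗ Y ^ᵠ 6                ≈⟨ ⊗-cong (≋-refl {Y}) Y⁶≋ ⟩
      Y ⊗ (ι (c ^ 5) ⊗ Ȳ)       ≈⟨ x∙yz≈y∙xz Y (ι (c ^ 5)) Ȳ ⟩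
      ι (c ^ 5) ⊗ (Y ⊗ Ȳ)       ≡⟨ cong (ι (c ^ 5) ⊗_) Y⊗Ȳ≡ι ⟩
      ι (c ^ 5) ⊗ ι w           ≡⟨ ι-⊗ (c ^ 5) w ⟩
      ι (c ^ 5 * w)             ≡⟨ cong ι (≡.trans (cong (c ^ 5 *_) w≡c²) c⁵c²≡c⁷) ⟩
      ι (c ^ 7)                 ∎
      where
      open import Relation.Binary.Reasoning.Setoid setoid
      open import Algebra.Properties.CommutativeSemigroup (CommutativeSemiring.*-commutativeSemigroup commutativeSemiring)
        using (x∙yz≈y∙xz)
      c⁵c²≡c⁷ : c ^ 5 * (c * c) ≡ c ^ 7
      c⁵c²≡c⁷ = ≡.trans (cong (λ z → c ^ 5 * (c * z)) (≡.sym (ℤₚ.*-identityʳ c))) (≡.sym (ℤₚ.^-distribˡ-+-* c 5 2))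

    Y^[r+7k]≋ : Y ^ᵠ 7 ≋ ι (c ^ 7) → ∀ r k → Y ^ᵠ (r ℕ.+ k ℕ.* 7) ≋ Y ^ᵠ r ⊗ ι (c ^ (k ℕ.* 7))
    Y^[r+7k]≋ Y⁷≋ r k = begin
      Y ^ᵠ (r ℕ.+ k ℕ.* 7)          ≈⟨ ^-homo-* Y r (k ℕ.* 7) ⟩
      Y ^ᵠ r ⊗ Y ^ᵠ (k ℕ.* 7)       ≈⟨ ⊗-cong (≋-refl {Y ^ᵠ r}) (^-congʳ Y (ℕₚ.*-comm k 7)) ⟩
      Y ^ᵠ r ⊗ Y ^ᵠ (7 ℕ.* k)       ≈⟨ ⊗-cong (≋-refl {Y ^ᵠ r}) (^-assocʳ Y 7 k) ⟨
      Y ^ᵠ r ⊗ (Y ^ᵠ 7) ^ᵠ k        ≈⟨ ⊗-cong (≋-refl {Y ^ᵠ r}) (≋-trans (^-congˡ k Y⁷≋) (ι-^ᵠ (c ^ 7) k)) ⟩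
      Y ^ᵠ r ⊗ ι ((c ^ 7) ^ k)      ≡⟨ cong (λ z → Y ^ᵠ r ⊗ ι z) (≡.trans (ℤₚ.^-*-assoc c 7 k) (cong (c ^_) (ℕₚ.*-comm 7 k))) ⟩
      Y ^ᵠ r ⊗ ι (c ^ (k ℕ.* 7))    ∎
      where open import Relation.Binary.Reasoning.Setoid setoid

    module _ (n-prime : Prime n) (n∤c : ¬ + n ∣ c) {k : ℕ} where

      private
        c^[n-1]≡1 : ι (c ^ ℕ.pred n) ≋ ι (+ 1)
        c^[n-1]≡1 = ι-cong (fermat-little n-prime n∤c)

      Y^n≋Y : Y ^ᵠ 7 ≋ ι (c ^ 7) → n ≡ 1 ℕ.+ k ℕ.* 7 → Y ^ᵠ n ≋ Y
      Y^n≋Y Y⁷≋ refl = begin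
        Y ^ᵠ (1 ℕ.+ k ℕ.* 7)          ≈⟨ Y^[r+7k]≋ Y⁷≋ 1 k ⟩
        Y ^ᵠ 1 ⊗ ι (c ^ (k ℕ.* 7))    ≈⟨ ⊗-cong (*-identityʳ Y) c^[n-1]≡1 ⟩
        Y ⊗ ι (+ 1)                   ≈⟨ *-identityʳ Y ⟩
        Y                             ∎
        where open import Relation.Binary.Reasoning.Setoid setoid

      Y^n≋Ȳ : w ≡ c * c → Y ^ᵠ 6 ≋ ι (c ^ 5) ⊗ Ȳ → n ≡ 6 ℕ.+ k ℕ.* 7 → Y ^ᵠ n ≋ Ȳ
      Y^n≋Ȳ w≡c² Y⁶≋ refl = begin
        Y ^ᵠ (6 ℕ.+ k ℕ.* 7)                   ≈⟨ Y^[r+7k]≋ (Y⁶≋⇒Y⁷≋ w≡c² Y⁶≋) 6 k ⟩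
        Y ^ᵠ 6 ⊗ ι (c ^ (k ℕ.* 7))             ≈⟨ ⊗-cong Y⁶≋ (≋-refl {ι (c ^ (k ℕ.* 7))}) ⟩
        ι (c ^ 5) ⊗ Ȳ ⊗ ι (c ^ (k ℕ.* 7))      ≈⟨ xy∙z≈y∙xz (ι (c ^ 5)) Ȳ (ι (c ^ (k ℕ.* 7))) ⟩
        Ȳ ⊗ (ι (c ^ 5) ⊗ ι (c ^ (k ℕ.* 7)))    ≡⟨ cong (Ȳ ⊗_) (≡.trans (ι-⊗ (c ^ 5) _) (cong ι (≡.sym (ℤₚ.^-distribˡ-+-* c 5 (k ℕ.* 7))))) ⟩
        Ȳ ⊗ ι (c ^ ℕ.pred n)                   ≈⟨ ⊗-cong (≋-refl {Ȳ}) c^[n-1]≡1 ⟩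
        Ȳ ⊗ ι (+ 1)                            ≈⟨ *-identityʳ Ȳ ⟩
        Ȳ                                      ∎
        where
        open import Relation.Binary.Reasoning.Setoid setoid
        open import Algebra.Properties.CommutativeSemigroup (CommutativeSemiring.*-commutativeSemigroup commutativeSemiring)
          using (xy∙z≈y∙xz)

-- The ring solver treats ℤ's _^_ as an opaque constant, so f₇ and g₇ are first restated with _*_ alone.
f7-expanded : ∀ a b → f7 a b ≡ a * a * a + + 5 * a * a * b - + 8 * a * b * b + b * b * b
f7-expanded = unfolded
  where
  unfolded : ∀ a b → a * (a * (a * + 1)) + + 5 * (a * (a * + 1)) * b - + 8 * a * (b * (b * + 1)) + b * (b * (b * + 1)) ≡
                     a * a * a + + 5 * a * a * b - + 8 * a * b * b + b * b * b
  unfolded = solve-∀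

g7-expanded : ∀ a b → g7 a b ≡ a * a - a * b + b * b
g7-expanded = unfolded
  where
  unfolded : ∀ a b → a * (a * + 1) - a * b + b * (b * + 1) ≡ a * a - a * b + b * b
  unfolded = solve-∀

f7-cube-form : ∀ a b → let c = a + + 4 * b in
  a * a * a + + 5 * a * a * b - + 8 * a * b * b + b * b * b ≡ c * c * c - + 7 * (c * c * b) + + 49 * (b * b * b)
f7-cube-form = solve-∀

cube-form-at-7t : ∀ t b → let c = t * + 7 in
  c * c * c - + 7 * (c * c * b) + + 49 * (b * b * b) ≡ (+ 7 * (t * t * t) - + 7 * (t * t * b) + b * b * b) * + 49
cube-form-at-7t = solve-∀

cube-form≡c³-mod-7 : ∀ c b → c * c * c - + 7 * (c * c * b) + + 49 * (b * b * b) - c * c * c ≡ (+ 7 * (b * b * b) - c * c * b) * + 7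
cube-form≡c³-mod-7 = solve-∀

f7-homogeneous : ∀ A B Q → let a = A * Q ; b = B * Q in
  a * a * a + + 5 * a * a * b - + 8 * a * b * b + b * b * b ≡ (A * A * A + + 5 * A * A * B - + 8 * A * B * B + B * B * B) * Q * Q * Q
f7-homogeneous = solve-∀

f7≡a³-mod-b : ∀ a b → a * a * a + + 5 * a * a * b - + 8 * a * b * b + b * b * b - (+ 5 * a * a - + 8 * a * b + b * b) * b ≡ a ^ 3
f7≡a³-mod-b = unfolded
  where
  unfolded : ∀ a b → a * a * a + + 5 * a * a * b - + 8 * a * b * b + b * b * b - (+ 5 * a * a - + 8 * a * b + b * b) * b ≡ a * (a * (a * + 1))
  unfolded = solve-∀

-- A prime dividing f₇(a,b) and one of v = 2a + b, g₇(a,b), W = a² + 2ab − b² divides 49b.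
bezout-v : ∀ a b → let F = a * a * a + + 5 * a * a * b - + 8 * a * b * b + b * b * b in
  + 8 * F + (+ 41 * b * b - + 18 * a * b - + 4 * a * a) * (+ 2 * a + b) ≡ + 49 * (b * b * b)
bezout-v = solve-∀

bezout-g : ∀ a b → let F = a * a * a + + 5 * a * a * b - + 8 * a * b * b + b * b * b in
  (+ 3 * a - + 8 * b) * F + (+ 57 * b * b - + 10 * a * b - + 3 * a * a) * (a * a - a * b + b * b) ≡ + 49 * (b * b * b * b)
bezout-g = solve-∀

bezout-W : ∀ a b → let F = a * a * a + + 5 * a * a * b - + 8 * a * b * b + b * b * b in
  (- (+ 30) * b - + 13 * a) * F + (+ 13 * a * a + + 69 * a * b - + 79 * b * b) * (a * a + + 2 * a * b - b * b) ≡ + 49 * (b * b * b * b)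
bezout-W = solve-∀

X*D≡[7W]²-49bF : ∀ a b → let F = a * a * a + + 5 * a * a * b - + 8 * a * b * b + b * b * b
                             u = + 2 * b - + 3 * a ; v = + 2 * a + b ; W = a * a + + 2 * a * b - b * b in
  - (+ 7 * (a * a - a * b + b * b)) * (u * u - + 4 * (v * v)) - (+ 7 * W) * (+ 7 * W) ≡ (- (+ 49) * b) * F
X*D≡[7W]²-49bF = solve-∀

-- U₀ … U₆ unfold to lucas 0 … lucas 6 for u = 2b − 3a and w = v², so by Y^[1+k]≡lucas these
-- say Y⁶ ≡ v⁵(u − Y) modulo f₇(a,b).
lucas-coefficient₀ : ∀ a b →
  let F = a * a * a + + 5 * a * a * b - + 8 * a * b * b + b * b * b
      u = + 2 * b - + 3 * a ; v = + 2 * a + b ; w = v * v ; v⁵ = v * (v * (v * (v * (v * + 1))))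
      U₀ = + 0 ; U₁ = + 1 ; U₂ = u * U₁ - w * U₀ ; U₃ = u * U₂ - w * U₁
      U₄ = u * U₃ - w * U₂ ; U₅ = u * U₄ - w * U₃ ; U₆ = u * U₅ - w * U₄ in
  - (w * U₅) - v⁵ * u ≡ (+ 140 * a * a * a + + 112 * a * a * b + + 7 * a * b * b - + 7 * b * b * b) * F
lucas-coefficient₀ = solve-∀

lucas-coefficient₁ : ∀ a b →
  let F = a * a * a + + 5 * a * a * b - + 8 * a * b * b + b * b * b
      u = + 2 * b - + 3 * a ; v = + 2 * a + b ; w = v * v ; v⁵ = v * (v * (v * (v * (v * + 1))))
      U₀ = + 0 ; U₁ = + 1 ; U₂ = u * U₁ - w * U₀ ; U₃ = u * U₂ - w * U₁
      U₄ = u * U₃ - w * U₂ ; U₅ = u * U₄ - w * U₃ ; U₆ = u * U₅ - w * U₄ in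
  U₆ - - v⁵ ≡ (+ 77 * a * a - + 119 * a * b + + 7 * b * b) * F
lucas-coefficient₁ = solve-∀

7-prime : Prime 7
7-prime = toWitness {a? = prime? 7} _

prime∤49 : ∀ {p} → Prime p → ¬ + 49 ∣ + p
prime∤49 {p} p-prime 49∣p with prime∣prime⇒≡ 7-prime p-prime (ℕᵈ.∣-trans {7} {49} {p} (ℕᵈ.divides 7 refl) (∣⇒∣ᵤ 49∣p))
... | refl with ℕᵈ.∣⇒≤ (∣⇒∣ᵤ 49∣p)
...   | s≤s (s≤s (s≤s (s≤s (s≤s (s≤s (s≤s ()))))))

sixth-power : ∀ c → (c * c * c) * (c * c * c) ≡ c ^ 6
sixth-power = unfolded
  where
  unfolded : ∀ c → (c * c * c) * (c * c * c) ≡ c * (c * (c * (c * (c * (c * + 1)))))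
  unfolded = solve-∀

module PrimeValue (a b : ℤ) {q : ℕ} (q-prime : Prime q) (f7≡q : f7 a b ≡ + q) where

  private
    instance _ = prime⇒nonZero q-prime
    F c u v W X D : ℤ
    F = a * a * a + + 5 * a * a * b - + 8 * a * b * b + b * b * b
    c = a + + 4 * b
    u = + 2 * b - + 3 * a
    v = + 2 * a + b
    W = a * a + + 2 * a * b - b * b
    X = - (+ 7 * g7 a b)
    D = u * u - + 4 * (v * v)

    F≡q : F ≡ + q
    F≡q = ≡.trans (≡.sym (f7-expanded a b)) f7≡q

    q≡c³ : + q ≡ c * c * c mod 7
    q≡c³ = ≡-mod-trans (≡-mod-reflexive (≡.trans (≡.sym F≡q) (f7-cube-form a b)))
                       (congruent (divides (+ 7 * (b * b * b) - c * c * b) (cube-form≡c³-mod-7 c b)))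
    7∤c : ¬ + 7 ∣ c
    7∤c (divides t c≡t*7) = prime∤49 q-prime (divides (+ 7 * (t * t * t) - + 7 * (t * t * b) + b * b * b) (begin
      + q                                                   ≡⟨ F≡q ⟨
      F                                                     ≡⟨ f7-cube-form a b ⟩
      c * c * c - + 7 * (c * c * b) + + 49 * (b * b * b)    ≡⟨ cong (λ z → z * z * z - + 7 * (z * z * b) + + 49 * (b * b * b)) c≡t*7 ⟩
      (t * + 7) * (t * + 7) * (t * + 7) - + 7 * ((t * + 7) * (t * + 7) * b) + + 49 * (b * b * b)
                                                            ≡⟨ cube-form-at-7t t b ⟩
      (+ 7 * (t * t * t) - + 7 * (t * t * b) + b * b * b) * + 49 ∎))
      where open ≡.≡-Reasoning

  q≡±1-mod-7 : q % 7 ≡ 1 ⊎ q % 7 ≡ 6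
  q≡±1-mod-7 = Sum.map
    (λ c³≡1  → ≡-mod⇒% (s≤s (s≤s z≤n)) (≡-mod-trans q≡c³ c³≡1))
    (λ c³≡-1 → ≡-mod⇒% ℕₚ.≤-refl (≡-mod-trans q≡c³ (≡-mod-trans c³≡-1 (-1≡n-mod-1+n 6))))
    (x²≡1⇒x≡±1 7-prime (≡-mod-trans (≡-mod-reflexive (sixth-power c)) (fermat-little 7-prime 7∤c)))

  private
    q≢7 : q ≢ 7
    q≢7 q≡7 = Sum.[ (λ ()) , (λ ()) ] (≡.subst (λ m → m % 7 ≡ 1 ⊎ m % 7 ≡ 6) q≡7 q≡±1-mod-7)

    q≢2 : q ≢ 2
    q≢2 q≡2 = Sum.[ (λ ()) , (λ ()) ] (≡.subst (λ m → m % 7 ≡ 1 ⊎ m % 7 ≡ 6) q≡2 q≡±1-mod-7)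

    q∤7 : ¬ + q ∣ + 7
    q∤7 q∣7 = q≢7 (prime∣prime⇒≡ q-prime 7-prime (∣⇒∣ᵤ q∣7))

    q∣F : + q ∣ F
    q∣F = divides (+ 1) (≡.trans F≡q (≡.sym (ℤₚ.*-identityˡ (+ q))))

    ∤-by-combination : ∀ A B {h} t → A * F + B * h ≡ + 49 * t → ¬ + q ∣ t → ¬ + q ∣ h
    ∤-by-combination A B t combination q∤t q∣h = Sum.[ ∤*∤ q-prime q∤7 q∤7 , q∤t ] (∣*⇒∣⊎∣ q-prime q∣49t)
      where
      q∣49t : + q ∣ + 49 * t
      q∣49t = ≡.subst (+ q ∣_) combination (∣m∣n⇒∣m+n (∣n⇒∣m*n A q∣F) (∣n⇒∣m*n B q∣h))

    q∤b : ¬ + q ∣ b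
    q∤b q∣b = both-divisible (∣^⇒∣ q-prime 3 q∣a³) q∣b
      where
      q∣a³ : + q ∣ a ^ 3
      q∣a³ = ≡.subst (+ q ∣_) (f7≡a³-mod-b a b) (∣m∣n⇒∣m-n q∣F (∣n⇒∣m*n (+ 5 * a * a - + 8 * a * b + b * b) q∣b))

      both-divisible : + q ∣ a → + q ∣ b → ⊥
      both-divisible (divides A a≡Aq) (divides B b≡Bq) = ¬prime[1] (≡.subst Prime (ℕᵈ.∣1⇒≡1 (∣⇒∣ᵤ q∣1)) q-prime)
        where
        F′ = A * A * A + + 5 * A * A * B - + 8 * A * B * B + B * B * B
        F′q³≡q : F′ * + q * + q * + q ≡ + 1 * + q
        F′q³≡q = begin
          F′ * + q * + q * + q                  ≡⟨ f7-homogeneous A B (+ q) ⟨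
          _                                     ≡⟨ ≡.cong₂ (λ a b → a * a * a + + 5 * a * a * b - + 8 * a * b * b + b * b * b) a≡Aq b≡Bq ⟨
          F                                     ≡⟨ F≡q ⟩
          + q                                   ≡⟨ ℤₚ.*-identityˡ (+ q) ⟨
          + 1 * + q                             ∎
          where open ≡.≡-Reasoning
        q∣1 : + q ∣ + 1
        q∣1 = divides (F′ * + q) (≡.sym (ℤₚ.*-cancelʳ-≡ _ _ (+ q) F′q³≡q))

    q∤b³ : ¬ + q ∣ b * b * b
    q∤b³ = ∤*∤ q-prime (∤*∤ q-prime q∤b q∤b) q∤b

    q∤b⁴ : ¬ + q ∣ b * b * b * b
    q∤b⁴ = ∤*∤ q-prime q∤b³ q∤b

    q∤v : ¬ + q ∣ v
    q∤v = ∤-by-combination (+ 8) (+ 41 * b * b - + 18 * a * b - + 4 * a * a) (b * b * b) (bezout-v a b) q∤b³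

    q∤W : ¬ + q ∣ W
    q∤W = ∤-by-combination (- (+ 30) * b - + 13 * a) (+ 13 * a * a + + 69 * a * b - + 79 * b * b) (b * b * b * b)
                           (bezout-W a b) q∤b⁴

    q∤X : ¬ + q ∣ X
    q∤X q∣X = ∤*∤ q-prime q∤7 q∤g (≡.subst (+ q ∣_) (ℤₚ.neg-involutive _) (∣m⇒∣-m q∣X))
      where
      q∤g : ¬ + q ∣ g7 a b
      q∤g rewrite g7-expanded a b =
        ∤-by-combination (+ 3 * a - + 8 * b) (+ 57 * b * b - + 10 * a * b - + 3 * a * a) (b * b * b * b) (bezout-g a b) q∤b⁴

    XD≡[7W]² : X * D ≡ (+ 7 * W) * (+ 7 * W) mod q
    XD≡[7W]² = ≡.subst (λ g → - (+ 7 * g) * (u * u - + 4 * (v * v)) ≡ (+ 7 * W) * (+ 7 * W) mod q) (≡.sym (g7-expanded a b))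
      (congruent (divides (- (+ 49) * b) (≡.trans (X*D≡[7W]²-49bF a b) (cong (- (+ 49) * b *_) F≡q))))

    open QuadraticExtension q u (v * v)
      using (Y; Ȳ; ι; _⊗_; _≋_; _,_; _^ᵠ_; ≋-reflexive; lucas; ι⊗Ȳ; Y^[1+k]≡lucas; Y⁶≋⇒Y⁷≋; Y^n≋Y; Y^n≋Ȳ;
             Y^n≋⇒discriminant^[n/2]≡coeff₁; commutativeSemiring)
    open CommutativeSemiring commutativeSemiring using () renaming (trans to ≋-trans)

    Y⁶≋v⁵Ȳ : Y ^ᵠ 6 ≋ ι (v ^ 5) ⊗ Ȳ
    Y⁶≋v⁵Ȳ = ≋-trans (≋-reflexive (Y^[1+k]≡lucas 5)) (≋-trans (coeff₀≡ , coeff₁≡) (≋-reflexive (≡.sym (ι⊗Ȳ (v ^ 5)))))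
      where
      coeff₀≡ : - (v * v * lucas 5) ≡ v ^ 5 * u mod q
      coeff₀≡ = congruent (divides K₀ (≡.trans (lucas-coefficient₀ a b) (cong (K₀ *_) F≡q)))
        where K₀ = + 140 * a * a * a + + 112 * a * a * b + + 7 * a * b * b - + 7 * b * b * b
      coeff₁≡ : lucas 6 ≡ - v ^ 5 mod q
      coeff₁≡ = congruent (divides K₁ (≡.trans (lucas-coefficient₁ a b) (cong (K₁ *_) F≡q)))
        where K₁ = + 77 * a * a - + 119 * a * b + + 7 * b * b

    q≡r+[q/7]*7 : ∀ {r} → q % 7 ≡ r → q ≡ r ℕ.+ q / 7 ℕ.* 7
    q≡r+[q/7]*7 q%7≡r = ≡.trans (m≡m%n+[m/n]*n q 7) (cong (ℕ._+ q / 7 ℕ.* 7) q%7≡r)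

  q≡1-mod-7⇒legendre≡1 : q % 7 ≡ 1 → legendre (- (+ 7 * g7 a b)) q ≡ + 1
  q≡1-mod-7⇒legendre≡1 q%7≡1 = x^[p/2]≡1⇒legendre≡1 q-prime q≢2 q∤X
    (x*d≡s²⇒x^[p/2]≡d^[p/2] q-prime q≢2 (∤*∤ q-prime q∤7 q∤W) XD≡[7W]² refl
      (Y^n≋⇒discriminant^[n/2]≡coeff₁ q-prime q≢2
        (Y^n≋Y {c = v} q-prime q∤v {k = q / 7} (Y⁶≋⇒Y⁷≋ {c = v} refl Y⁶≋v⁵Ȳ) (q≡r+[q/7]*7 q%7≡1))))

  q≡6-mod-7⇒legendre≡-1 : q % 7 ≡ 6 → legendre (- (+ 7 * g7 a b)) q ≡ -[1+ 0 ]
  q≡6-mod-7⇒legendre≡-1 q%7≡6 = x^[p/2]≡-1⇒legendre≡-1 q-prime q≢2 q∤X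
    (x*d≡s²⇒x^[p/2]≡d^[p/2] q-prime q≢2 (∤*∤ q-prime q∤7 q∤W) XD≡[7W]² refl
      (Y^n≋⇒discriminant^[n/2]≡coeff₁ q-prime q≢2
        (Y^n≋Ȳ {c = v} q-prime q∤v {k = q / 7} refl Y⁶≋v⁵Ȳ (q≡r+[q/7]*7 q%7≡6))))

lemma6p6 : (a b : ℤ) (q : ℕ) → Prime q → f7 a b ≡ + q →
    ((q % 7 ≡ 1) ⊎ (q % 7 ≡ 6))
    × ((q % 7 ≡ 1) ⇔ (legendre (- (+ 7 * g7 a b)) q ≡ + 1))
    × ((q % 7 ≡ 6) ⇔ (legendre (- (+ 7 * g7 a b)) q ≡ -[1+ 0 ]))
lemma6p6 a b q q-prime f7≡q =
  q≡±1-mod-7 , mk⇔ q≡1-mod-7⇒legendre≡1 legendre≡1⇒q≡1 , mk⇔ q≡6-mod-7⇒legendre≡-1 legendre≡-1⇒q≡6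
  where
  open PrimeValue a b q-prime f7≡q

  legendre≡1⇒q≡1 : legendre (- (+ 7 * g7 a b)) q ≡ + 1 → q % 7 ≡ 1
  legendre≡1⇒q≡1 legendre≡1 = Sum.[ id , (λ q≡6 → contradiction (≡.trans (≡.sym legendre≡1) (q≡6-mod-7⇒legendre≡-1 q≡6)) λ ()) ]
    q≡±1-mod-7

  legendre≡-1⇒q≡6 : legendre (- (+ 7 * g7 a b)) q ≡ -[1+ 0 ] → q % 7 ≡ 6
  legendre≡-1⇒q≡6 legendre≡-1 = Sum.[ (λ q≡1 → contradiction (≡.trans (≡.sym legendre≡-1) (q≡1-mod-7⇒legendre≡1 q≡1)) λ ()) , id ]
    q≡±1-mod-7
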